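{- Let $q$ be a prime power, $n,m$ positive integers, and let $\mathcal{C}\subseteq\mathcal{L}_{n,q}[X_1,\dots,X_m]$ be an $\mathbb{F}_{q^n}$-linear rank-metric code. The following are equivalent: (a) $\mathcal{C}$ is nondegenerate; (b) for any $\mathbb{F}_{q^n}$-basis $(g_1,\dots,g_k)$ of $\mathcal{C}$, $\bigcap_{i=1}^k\ker(g_i)=\{0\}$; (c) $\bigcap_{f\in\mathcal{C}}\ker(f)=\{0\}$; (d) $d_{\mathrm{rk}}(\mathcal{C}^\perp)>1$.
   Context: $\mathcal{L}_{n,q}[X_1,\dots,X_m]$ is the $\mathbb{F}_{q^n}$-vector space with basis $\{X_i^{q^j}:1\le i\le m,\ 0\le j\le n-1\}$; each $f=\sum_{i,j}f_{i,j}X_i^{q^j}$ defines an $\mathbb{F}_q$-linear map $\mathbb{F}_{q^n}^m\to\mathbb{F}_{q^n}$, $v\mapsto f(v)$, whose kernel is $\ker(f)$ and whose $\mathbb{F}_q$-rank is $\mathrm{rk}(f)$. An $\mathbb{F}_{q^n}$-linear rank-metric code is an $\mathbb{F}_{q^n}$-subspace $\mathcal{C}$ of this space; its minimum distance is $d_{\mathrm{rk}}(\mathcal{C})=\min\{\mathrm{rk}(f):f\in\mathcal{C}\setminus\{0\}\}$. For $f=\sum f_{i,j}X_i^{q^j}$ and $g=\sum g_{i,j}X_i^{q^j}$ put $f\star g:=\sum_{i,j}f_{i,j}g_{i,j}$, and $\mathcal{C}^\perp:=\{f: f\star g=0\ \forall g\in\mathcal{C}\}$. For an $\mathbb{F}_{q^n}$-basis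 $\mathcal{G}=(g_1,\dots,g_k)$ of $\mathcal{C}$, let $U_{\mathcal{G}}:=\{(g_1(x),\dots,g_k(x)):x\in\mathbb{F}_{q^n}^m\}\subseteq\mathbb{F}_{q^n}^k$; its $\mathbb{F}_q$-dimension does not depend on the choice of basis, and $\mathcal{C}$ is called nondegenerate if $\dim_{\mathbb{F}_q}(U_{\mathcal{G}})=nm$. -}

module Defs where

open import Level using (Level; _⊔_; suc)
open import Data.Nat using (ℕ; zero; _^_; _≤_; _<_) renaming (suc to sucℕ; _*_ to _*ℕ_)
open import Data.Nat.Primality using (Prime)
open import Data.Fin using (Fin)
import Data.Fin as Fin
open import Data.Product using (Σ; ∃; _×_)
open import Relation.Binary.PropositionalEquality using (_≡_)
open import Relation.Nullary using (¬_)
open import Algebra.Bundles using (CommutativeRing)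

IsPrimePower : ℕ → Set
IsPrimePower q = Σ ℕ λ p → Σ ℕ λ e → Prime p × (1 ≤ e) × (q ≡ p ^ e)

record Field (c ℓ : Level) : Set (suc (c ⊔ ℓ)) where
  field
    commutativeRing : CommutativeRing c ℓ
  open CommutativeRing commutativeRing public
  field
    0≉1     : ¬ (0# ≈ 1#)
    inverse : ∀ x → ¬ (x ≈ 0#) → Σ Carrier λ y → x * y ≈ 1#

record HasCardinality {c ℓ} (F : Field c ℓ) (N : ℕ) : Set (c ⊔ ℓ) where
  open Field F
  field
    enum       : Fin N → Carrier
    enum-inj   : ∀ i j → enum i ≈ enum j → i ≡ j
    enum-surj  : ∀ x → Σ (Fin N) λ i → enum i ≈ x

module LinearizedPolynomials {c ℓ} (F : Field c ℓ) (q n m : ℕ) where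
  open Field F

  pow : Carrier → ℕ → Carrier
  pow x zero     = 1#
  pow x (sucℕ e) = x * pow x e

  sumFin : ∀ {k} → (Fin k → Carrier) → Carrier
  sumFin {zero}   f = 0#
  sumFin {sucℕ k} f = f Fin.zero + sumFin (λ i → f (Fin.suc i))

  -- F_q inside F_{q^n}: the elements fixed by x ↦ x^q
  IsFq : Carrier → Set ℓ
  IsFq x = pow x q ≈ x

  Vect : ℕ → Set c
  Vect k = Fin k → Carrier

  -- elements of L_{n,q}[X_1,…,X_m]:  f = Σ_{i,j} f i j X_i^{q^j}
  LinPoly : Set c
  LinPoly = Fin m → Fin n → Carrier

  _≈P_ : LinPoly → LinPoly → Set ℓ
  f ≈P g = ∀ i j → f i j ≈ g i j

  0P : LinPoly
  0P i j = 0#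

  _+P_ : LinPoly → LinPoly → LinPoly
  (f +P g) i j = f i j + g i j

  _·P_ : Carrier → LinPoly → LinPoly
  (a ·P f) i j = a * f i j

  eval : LinPoly → Vect m → Carrier
  eval f v = sumFin λ i → sumFin λ j → f i j * pow (v i) (q ^ Fin.toℕ j)

  _⋆_ : LinPoly → LinPoly → Carrier
  f ⋆ g = sumFin λ i → sumFin λ j → f i j * g i j

  record IsCode {p} (C : LinPoly → Set p) : Set (c ⊔ ℓ ⊔ p) where
    field
      resp  : ∀ {f g} → f ≈P g → C f → C g
      zero∈ : C 0P
      +∈    : ∀ {f g} → C f → C g → C (f +P g)
      ·∈    : ∀ a {f} → C f → C (a ·P f)

  lincomb : ∀ {k} → (Fin k → Carrier) → (Fin k → LinPoly) → LinPoly
  lincomb a G i j = sumFin λ t → a t * G t i j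

  record IsBasis {p} (C : LinPoly → Set p) (k : ℕ) (G : Fin k → LinPoly)
         : Set (c ⊔ ℓ ⊔ p) where
    field
      in-C  : ∀ t → C (G t)
      indep : ∀ (a : Fin k → Carrier) → lincomb a G ≈P 0P → ∀ t → a t ≈ 0#
      span  : ∀ f → C f → Σ (Fin k → Carrier) λ a → f ≈P lincomb a G

  record HasFqDim {k p} (U : Vect k → Set p) (d : ℕ) : Set (c ⊔ ℓ ⊔ p) where
    field
      vec   : Fin d → Vect k
      in-U  : ∀ t → U (vec t)
      indep : ∀ (a : Fin d → Carrier) → (∀ t → IsFq (a t)) →
              (∀ s → sumFin (λ t → a t * vec t s) ≈ 0#) → ∀ t → a t ≈ 0#
      span  : ∀ w → U w → Σ (Fin d → Carrier) λ a → (∀ t → IsFq (a t)) ×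
              (∀ s → w s ≈ sumFin (λ t → a t * vec t s))

  U[_] : ∀ {k} → (Fin k → LinPoly) → Vect k → Set (c ⊔ ℓ)
  U[ G ] w = Σ (Vect m) λ x → ∀ t → w t ≈ eval (G t) x

  -- image of f, as a subset of F_{q^n}^1 = F_{q^n}
  Im : LinPoly → Vect 1 → Set (c ⊔ ℓ)
  Im f w = Σ (Vect m) λ x → ∀ s → w s ≈ eval f x

  HasRank : LinPoly → ℕ → Set (c ⊔ ℓ)
  HasRank f r = HasFqDim (Im f) r

  Nondegenerate : ∀ {p} → (LinPoly → Set p) → Set (c ⊔ ℓ ⊔ p)
  Nondegenerate C = ∀ k (G : Fin k → LinPoly) → IsBasis C k G → HasFqDim U[ G ] (n *ℕ m)

  IsZeroVec : Vect m → Set ℓ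
  IsZeroVec x = ∀ i → x i ≈ 0#

  BasisKernelsTrivial : ∀ {p} → (LinPoly → Set p) → Set (c ⊔ ℓ ⊔ p)
  BasisKernelsTrivial C = ∀ k (G : Fin k → LinPoly) → IsBasis C k G →
    ∀ (x : Vect m) → (∀ t → eval (G t) x ≈ 0#) → IsZeroVec x

  KernelsTrivial : ∀ {p} → (LinPoly → Set p) → Set (c ⊔ ℓ ⊔ p)
  KernelsTrivial C = ∀ (x : Vect m) → (∀ f → C f → eval f x ≈ 0#) → IsZeroVec x

  Dual : ∀ {p} → (LinPoly → Set p) → LinPoly → Set (c ⊔ ℓ ⊔ p)
  Dual C f = ∀ g → C g → f ⋆ g ≈ 0#

  -- d_rk(D) > 1 : every nonzero f ∈ D has rank > 1 (min over ∅ is ∞)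
  MinDistGreaterThanOne : ∀ {p} → (LinPoly → Set p) → Set (c ⊔ ℓ ⊔ p)
  MinDistGreaterThanOne D = ∀ f → D f → ¬ (f ≈P 0P) → ∀ r → HasRank f r → 1 < r

-- Evaluation x ↦ (g₁(x), …, g_k(x)) at a basis of C is an F_q-linear map on F^m = F_(q^n)^m, a
-- space with q^(nm) elements, so its image U_G has F_q-dimension nm exactly when it is injective,
-- i.e. when the kernels of the gᵢ, or of all f ∈ C, meet only in 0.  For (d): a rank-one f is a
-- scalar w times an F_q-valued polynomial, and F_q-valued linearized polynomials have coefficients
-- bᵢ^(q^j); then f ⋆ g = w·g(b), so C^⊥ contains a nonzero f of rank one exactly when some
-- nonzero b lies in every kernel.  The counting uses |F_q| = q, which follows from root bounds
-- for X^q - X and, on the complement of F_q, for 1 + Y + … + Y^(M-1) with Y = X^(q-1) and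
-- M = (q^n - 1)/(q - 1).
module Submission where

open import Defs

open import Level using (Level; _⊔_)
open import Data.Nat as ℕ using (ℕ; zero; suc; _≤_; _<_; z≤n; s≤s)
import Data.Nat.Properties as ℕ
open import Data.Nat.Divisibility using (_∣_; divides; ∣⇒≤)
open import Data.Nat.Primality using (Prime; euclidsLemma; ¬prime[0]; ¬prime[1]; prime⇒nonZero)
open import Data.Nat.Combinatorics using (nCk+nC[k+1]≡[n+1]C[k+1]; k>n⇒nCk≡0; nC1≡n; nCn≡1) renaming (_C_ to _choose_)
open import Data.Nat.Tactic.RingSolver using (solve-∀)
open import Data.Fin as Fin using (Fin; zero; suc; toℕ)
import Data.Fin.Properties as Fin
open import Data.Product using (Σ; _×_; _,_; proj₁; proj₂)
open import Data.Sum using (inj₁; inj₂)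
open import Data.Empty using (⊥-elim)
open import Data.Unit using (⊤; tt)
open import Data.List using (List; []; _∷_; length; filter; tabulate; lookup)
open import Function using (_∘_)
open import Relation.Nullary using (¬_; Dec; yes; no; ¬?; _×-dec_; decidable-stable; ¬¬-excluded-middle)
open import Relation.Binary using (Setoid; tri<; tri≈; tri>)
open import Relation.Binary.PropositionalEquality as ≡ using (_≡_)

n<m^n : ∀ {m} n → 2 ≤ m → n < m ℕ.^ n
n<m^n zero _ = s≤s z≤n
n<m^n {m} (suc n) 2≤m = begin-strict
  suc n                   <⟨ s≤s (n<m^n n 2≤m) ⟩
  suc (m ℕ.^ n)           ≤⟨ ℕ.+-monoˡ-≤ (m ℕ.^ n) (ℕ.≤-trans (s≤s z≤n) (n<m^n n 2≤m)) ⟩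
  m ℕ.^ n ℕ.+ m ℕ.^ n     ≡⟨ ≡.cong (m ℕ.^ n ℕ.+_) (≡.sym (ℕ.+-identityʳ _)) ⟩
  2 ℕ.* m ℕ.^ n           ≤⟨ ℕ.*-monoˡ-≤ (m ℕ.^ n) 2≤m ⟩
  m ℕ.^ suc n             ∎
  where open ℕ.≤-Reasoning

^-injectiveʳ : ∀ {m a b} → 2 ≤ m → m ℕ.^ a ≡ m ℕ.^ b → a ≡ b
^-injectiveʳ {m} {a} {b} 2≤m eq with ℕ.<-cmp a b
... | tri< a<b _ _ = ⊥-elim (ℕ.<-irrefl eq (ℕ.^-monoʳ-< m 2≤m a<b))
... | tri≈ _ a≡b _ = a≡b
... | tri> _ _ b<a = ⊥-elim (ℕ.<-irrefl (≡.sym eq) (ℕ.^-monoʳ-< m 2≤m b<a))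

prime⇒2≤ : ∀ {p} → Prime p → 2 ≤ p
prime⇒2≤ {0} pr = ⊥-elim (¬prime[0] pr)
prime⇒2≤ {1} pr = ⊥-elim (¬prime[1] pr)
prime⇒2≤ {suc (suc p)} _ = s≤s (s≤s z≤n)

primePower⇒2≤ : ∀ {q} → IsPrimePower q → 2 ≤ q
primePower⇒2≤ (p , suc e , pr , _ , ≡.refl) =
  ℕ.≤-trans (prime⇒2≤ pr) (ℕ.m≤m*n p (p ℕ.^ e) {{ℕ.m^n≢0 p e {{prime⇒nonZero pr}}}})

[1+k]*[1+n]C[1+k]≡[1+n]*nCk : ∀ n k → suc k ℕ.* (suc n choose suc k) ≡ suc n ℕ.* (n choose k)
[1+k]*[1+n]C[1+k]≡[1+n]*nCk zero zero = ≡.refl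
[1+k]*[1+n]C[1+k]≡[1+n]*nCk zero (suc k)
  rewrite k>n⇒nCk≡0 {1} {suc (suc k)} (s≤s (s≤s z≤n)) | k>n⇒nCk≡0 {0} {suc k} (s≤s z≤n) = ℕ.*-zeroʳ k
[1+k]*[1+n]C[1+k]≡[1+n]*nCk (suc n) zero rewrite nC1≡n (suc (suc n)) = ℕ.*-comm 1 (suc (suc n))
[1+k]*[1+n]C[1+k]≡[1+n]*nCk (suc n) (suc k) = begin
  suc (suc k) ℕ.* (suc (suc n) choose suc (suc k))
    ≡⟨ ≡.cong (suc (suc k) ℕ.*_) (≡.sym (nCk+nC[k+1]≡[n+1]C[k+1] (suc n) (suc k))) ⟩
  suc (suc k) ℕ.* (a ℕ.+ b)
    ≡⟨ expand k a b ⟩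
  suc k ℕ.* a ℕ.+ a ℕ.+ suc (suc k) ℕ.* b
    ≡⟨ ≡.cong₂ (λ u v → u ℕ.+ a ℕ.+ v) ([1+k]*[1+n]C[1+k]≡[1+n]*nCk n k) ([1+k]*[1+n]C[1+k]≡[1+n]*nCk n (suc k)) ⟩
  suc n ℕ.* (n choose k) ℕ.+ a ℕ.+ suc n ℕ.* (n choose suc k)
    ≡⟨ collect n (n choose k) (n choose suc k) a ⟩
  suc n ℕ.* (n choose k ℕ.+ n choose suc k) ℕ.+ a
    ≡⟨ ≡.cong (λ u → suc n ℕ.* u ℕ.+ a) (nCk+nC[k+1]≡[n+1]C[k+1] n k) ⟩
  suc n ℕ.* a ℕ.+ a
    ≡⟨ ℕ.+-comm (suc n ℕ.* a) a ⟩
  suc (suc n) ℕ.* a ∎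
  where
  open ≡.≡-Reasoning
  a = suc n choose suc k
  b = suc n choose suc (suc k)
  expand : ∀ k a b → suc (suc k) ℕ.* (a ℕ.+ b) ≡ suc k ℕ.* a ℕ.+ a ℕ.+ suc (suc k) ℕ.* b
  expand = solve-∀
  collect : ∀ n x y a → suc n ℕ.* x ℕ.+ a ℕ.+ suc n ℕ.* y ≡ suc n ℕ.* (x ℕ.+ y) ℕ.+ a
  collect = solve-∀

prime∣pCk : ∀ {p k} → Prime p → 0 < k → k < p → p ∣ p choose k
prime∣pCk {suc n} {suc k} pr _ k<p
  with euclidsLemma (suc k) (suc n choose suc k) pr
         (divides (n choose k) (≡.trans ([1+k]*[1+n]C[1+k]≡[1+n]*nCk n k) (ℕ.*-comm (suc n) (n choose k))))
... | inj₂ p∣pCk = p∣pCk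
... | inj₁ p∣k = ⊥-elim (ℕ.<⇒≱ k<p (∣⇒≤ p∣k))

geometric : ℕ → ℕ → ℕ
geometric q zero    = 0
geometric q (suc n) = q ℕ.^ n ℕ.+ geometric q n

pred[q]*geometric+1≡q^n : ∀ q n .{{_ : ℕ.NonZero q}} → ℕ.pred q ℕ.* geometric q n ℕ.+ 1 ≡ q ℕ.^ n
pred[q]*geometric+1≡q^n (suc q′) zero    = ≡.cong (ℕ._+ 1) (ℕ.*-zeroʳ q′)
pred[q]*geometric+1≡q^n (suc q′) (suc n) = begin
  q′ ℕ.* (P ℕ.+ G) ℕ.+ 1        ≡⟨ distrib q′ P G ⟩
  q′ ℕ.* P ℕ.+ (q′ ℕ.* G ℕ.+ 1) ≡⟨ ≡.cong (q′ ℕ.* P ℕ.+_) (pred[q]*geometric+1≡q^n (suc q′) n) ⟩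
  q′ ℕ.* P ℕ.+ P                ≡⟨ ℕ.+-comm (q′ ℕ.* P) P ⟩
  suc q′ ℕ.^ suc n              ∎
  where
  open ≡.≡-Reasoning
  P = suc q′ ℕ.^ n
  G = geometric (suc q′) n
  distrib : ∀ q′ P G → q′ ℕ.* (P ℕ.+ G) ℕ.+ 1 ≡ q′ ℕ.* P ℕ.+ (q′ ℕ.* G ℕ.+ 1)
  distrib = solve-∀

geometric-nonZero : ∀ q n .{{_ : ℕ.NonZero q}} → 1 ≤ n → ℕ.NonZero (geometric q n)
geometric-nonZero q (suc n) _ = ℕ.>-nonZero (ℕ.≤-trans (ℕ.m^n>0 q n) (ℕ.m≤m+n (q ℕ.^ n) (geometric q n)))

pred[q]*M+1≡pred[q]*pred[M]+q : ∀ q M .{{_ : ℕ.NonZero q}} .{{_ : ℕ.NonZero M}} →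
                                ℕ.pred q ℕ.* M ℕ.+ 1 ≡ ℕ.pred q ℕ.* ℕ.pred M ℕ.+ q
pred[q]*M+1≡pred[q]*pred[M]+q (suc q′) (suc M′) = arith q′ M′
  where
  arith : ∀ q′ M′ → q′ ℕ.* suc M′ ℕ.+ 1 ≡ q′ ℕ.* M′ ℕ.+ suc q′
  arith = solve-∀

length-filter+length-filter¬ : ∀ {a p} {A : Set a} {P : A → Set p} (P? : ∀ x → Dec (P x)) xs →
                               length (filter P? xs) ℕ.+ length (filter (¬? ∘ P?) xs) ≡ length xs
length-filter+length-filter¬ P? []       = ≡.refl
length-filter+length-filter¬ P? (x ∷ xs) with P? x
... | yes _ = ≡.cong suc (length-filter+length-filter¬ P? xs)
... | no  _ = ≡.trans (ℕ.+-suc _ _) (≡.cong suc (length-filter+length-filter¬ P? xs))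

module _ {a ℓ} (S : Setoid a ℓ) where

  open Setoid S
  open import Data.List.Relation.Unary.Unique.Setoid S using (Unique)
  import Data.List.Relation.Unary.All as All
  open import Data.List.Relation.Unary.AllPairs using (_∷_)
  open import Data.List.Membership.Propositional.Properties using (∈-lookup)

  lookup-injective : ∀ {xs} → Unique xs → ∀ i j → lookup xs i ≈ lookup xs j → i ≡ j
  lookup-injective {x ∷ xs} _            zero    zero    _  = ≡.refl
  lookup-injective {x ∷ xs} (x≉xs ∷ _)   zero    (suc j) eq = ⊥-elim (All.lookup x≉xs (∈-lookup j) eq)
  lookup-injective {x ∷ xs} (x≉xs ∷ _)   (suc i) zero    eq = ⊥-elim (All.lookup x≉xs (∈-lookup i) (sym eq))
  lookup-injective {x ∷ xs} (_ ∷ unique) (suc i) (suc j) eq = ≡.cong suc (lookup-injective unique i j eq)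

injective⇒surjective : ∀ {m n} → m ≡ n → (f : Fin m → Fin n) → (∀ i j → f i ≡ f j → i ≡ j) →
                       ∀ j → Σ (Fin m) λ i → f i ≡ j
injective⇒surjective {suc n} ≡.refl f f-injective j with Fin.any? (λ i → f i Fin.≟ j)
... | yes hit = hit
... | no  miss = ⊥-elim (ℕ.<-irrefl ≡.refl (Fin.injective⇒≤ {f = g} g-injective))
  where
  f≢j : ∀ i → ¬ j ≡ f i
  f≢j i j≡fi = miss (i , ≡.sym j≡fi)
  g : Fin (suc n) → Fin n
  g i = Fin.punchOut (f≢j i)
  g-injective : ∀ {x y} → g x ≡ g y → x ≡ y
  g-injective {x} {y} gx≡gy = f-injective x y (Fin.punchOut-injective (f≢j x) (f≢j y) gx≡gy)

¬¬-decidable-Fin : ∀ {p} N (R : Fin N → Set p) → ¬ ¬ (∀ i → Dec (R i))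
¬¬-decidable-Fin zero    R no-dec = no-dec (λ ())
¬¬-decidable-Fin (suc N) R no-dec = ¬¬-excluded-middle λ dec₀ →
  ¬¬-decidable-Fin N (R ∘ suc) λ dec → no-dec λ { zero → dec₀ ; (suc i) → dec i }

record Enumeration {a ℓ p} {A : Set a} (_~_ : A → A → Set ℓ) (P : A → Set p) (size : ℕ) : Set (a ⊔ ℓ ⊔ p) where
  field
    element            : Fin size → A
    element-∈          : ∀ i → P (element i)
    element-injective  : ∀ i j → element i ~ element j → i ≡ j
    element-surjective : ∀ x → P x → Σ (Fin size) λ i → element i ~ x

funToFin-cong : ∀ {m n} {f g : Fin m → Fin n} → (∀ i → f i ≡ g i) → Fin.funToFin f ≡ Fin.funToFin g
funToFin-cong {zero}  _   = ≡.refl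
funToFin-cong {suc m} f≗g = ≡.cong₂ Fin.combine (f≗g zero) (funToFin-cong (f≗g ∘ suc))

finToFun-injective : ∀ {m n} {i j : Fin (n ℕ.^ m)} → (∀ k → Fin.finToFun i k ≡ Fin.finToFun j k) → i ≡ j
finToFun-injective {m} {n} {i} {j} eq = ≡.trans (≡.sym (Fin.funToFin-finToFin {m} {n} i))
  (≡.trans (funToFin-cong {m} {n} eq) (Fin.funToFin-finToFin {m} {n} j))

enumeration-→ : ∀ {a ℓ p} {A : Set a} {_~_ : A → A → Set ℓ} {P : A → Set p} {s} →
                Enumeration _~_ P s → ∀ d →
                Enumeration (λ u v → ∀ k → u k ~ v k) (λ (v : Fin d → A) → ∀ k → P (v k)) (s ℕ.^ d)
enumeration-→ {_~_ = _~_} {P = P} {s = s} E d = record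
  { element            = λ i k → element (Fin.finToFun i k)
  ; element-∈          = λ i k → element-∈ _
  ; element-injective  = λ i j eq → finToFun-injective {d} {s} (λ k → element-injective _ _ (eq k))
  ; element-surjective = λ v v∈ → Fin.funToFin (index v v∈) , λ k →
      ≡.subst (λ i → element i ~ v k) (≡.sym (Fin.finToFun-funToFin {d} {s} (index v v∈) k))
              (proj₂ (element-surjective (v k) (v∈ k)))
  }
  where
  open Enumeration E
  index : ∀ v → (∀ k → P (v k)) → Fin d → Fin s
  index v v∈ k = proj₁ (element-surjective (v k) (v∈ k))

module FieldProperties {c ℓ} (F : Field c ℓ) where

  open Field F hiding (zero)
  open import Algebra.Properties.Ring ring public
  open import Algebra.Properties.CommutativeSemiring.Exp commutativeSemiring public
  open import Algebra.Properties.CommutativeMonoid.Sum +-commutativeMonoid public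
    using (sum; sum-cong-≋; ∑-distrib-+; ∑-comm; sum-init-last)
  open import Algebra.Properties.Semiring.Sum semiring public
    using (*-distribˡ-sum; *-distribʳ-sum)
  open import Algebra.Properties.CommutativeSemigroup *-commutativeSemigroup public
    using () renaming (x∙yz≈y∙xz to x*[y*z]≈y*[x*z])
  import Relation.Binary.Reasoning.Setoid
  module ≈-Reasoning = Relation.Binary.Reasoning.Setoid setoid
  open ≈-Reasoning

  1≉0 : ¬ 1# ≈ 0#
  1≉0 1≈0 = 0≉1 (sym 1≈0)

  _⁻¹⟨_⟩ : ∀ x → ¬ x ≈ 0# → Carrier
  x ⁻¹⟨ x≉0 ⟩ = proj₁ (inverse x x≉0)

  *-inverseʳ : ∀ x (x≉0 : ¬ x ≈ 0#) → x * x ⁻¹⟨ x≉0 ⟩ ≈ 1#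
  *-inverseʳ x x≉0 = proj₂ (inverse x x≉0)

  *-inverseˡ : ∀ x (x≉0 : ¬ x ≈ 0#) → x ⁻¹⟨ x≉0 ⟩ * x ≈ 1#
  *-inverseˡ x x≉0 = trans (*-comm _ x) (*-inverseʳ x x≉0)

  *-cancelˡ : ∀ {a x y} → ¬ a ≈ 0# → a * x ≈ a * y → x ≈ y
  *-cancelˡ {a} {x} {y} a≉0 ax≈ay = begin
    x                          ≈⟨ *-identityˡ x ⟨
    1# * x                     ≈⟨ *-congʳ (*-inverseˡ a a≉0) ⟨
    (a ⁻¹⟨ a≉0 ⟩ * a) * x      ≈⟨ *-assoc _ a x ⟩
    a ⁻¹⟨ a≉0 ⟩ * (a * x)      ≈⟨ *-congˡ ax≈ay ⟩
    a ⁻¹⟨ a≉0 ⟩ * (a * y)      ≈⟨ *-assoc _ a y ⟨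
    (a ⁻¹⟨ a≉0 ⟩ * a) * y      ≈⟨ *-congʳ (*-inverseˡ a a≉0) ⟩
    1# * y                     ≈⟨ *-identityˡ y ⟩
    y                          ∎

  x*y≈0⇒y≈0 : ∀ {x y} → ¬ x ≈ 0# → x * y ≈ 0# → y ≈ 0#
  x*y≈0⇒y≈0 {x} x≉0 xy≈0 = *-cancelˡ x≉0 (trans xy≈0 (sym (zeroʳ x)))

  x*z≈y*z⇒z≈0 : ∀ {x y z} → ¬ x ≈ y → x * z ≈ y * z → z ≈ 0#
  x*z≈y*z⇒z≈0 {x} {y} {z} x≉y xz≈yz =
    x*y≈0⇒y≈0 (x≉y ∘ x∙y⁻¹≈ε⇒x≈y x y) (trans ([y-z]x≈yx-zx z x y) (x≈y⇒x∙y⁻¹≈ε xz≈yz))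

  *-nonZero : ∀ {x y} → ¬ x ≈ 0# → ¬ y ≈ 0# → ¬ x * y ≈ 0#
  *-nonZero x≉0 y≉0 xy≈0 = y≉0 (x*y≈0⇒y≈0 x≉0 xy≈0)

  ^-nonZero : ∀ {x} n → ¬ x ≈ 0# → ¬ x ^ n ≈ 0#
  ^-nonZero zero    _   = 1≉0
  ^-nonZero (suc n) x≉0 = *-nonZero x≉0 (^-nonZero n x≉0)

  1^n≈1 : ∀ n → 1# ^ n ≈ 1#
  1^n≈1 zero    = refl
  1^n≈1 (suc n) = trans (*-identityˡ _) (1^n≈1 n)

  record IsSubfield {k} (K : Carrier → Set k) : Set (c ⊔ ℓ ⊔ k) where
    field
      K-0    : K 0#
      K-1    : K 1#
      K-+    : ∀ {x y} → K x → K y → K (x + y)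
      K-*    : ∀ {x y} → K x → K y → K (x * y)
      K--    : ∀ {x} → K x → K (- x)
      K-⁻¹   : ∀ {x} (x≉0 : ¬ x ≈ 0#) → K x → K (x ⁻¹⟨ x≉0 ⟩)

  whole-isSubfield : IsSubfield (λ _ → ⊤)
  whole-isSubfield = record
    { K-0 = tt ; K-1 = tt ; K-+ = λ _ _ → tt ; K-* = λ _ _ → tt ; K-- = λ _ → tt ; K-⁻¹ = λ _ _ → tt }

  sum-zero : ∀ {k} {f : Fin k → Carrier} → (∀ i → f i ≈ 0#) → sum f ≈ 0#
  sum-zero {zero}  f≈0 = refl
  sum-zero {suc k} f≈0 = trans (+-cong (f≈0 zero) (sum-zero (f≈0 ∘ suc))) (+-identityˡ 0#)

  sum-neg : ∀ {k} (f : Fin k → Carrier) → sum (λ i → - f i) ≈ - sum f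
  sum-neg {zero}  f = sym -0#≈0#
  sum-neg {suc k} f = trans (+-congˡ (sum-neg (f ∘ suc))) (-‿+-comm _ _)

  sum-δ : ∀ {k} {f : Fin k → Carrier} (s : Fin k) → (∀ i → ¬ i ≡ s → f i ≈ 0#) → sum f ≈ f s
  sum-δ {suc k} zero    f≈0 = trans (+-congˡ (sum-zero (λ i → f≈0 (suc i) λ ()))) (+-identityʳ _)
  sum-δ {suc k} (suc s) f≈0 = trans (+-congʳ (f≈0 zero λ ())) (trans (+-identityˡ _)
    (sum-δ s (λ i i≢s → f≈0 (suc i) (i≢s ∘ Fin.suc-injective))))

  sum-last : ∀ {k} (f : Fin (suc k) → Carrier) → (∀ i → toℕ i < k → f i ≈ 0#) → sum f ≈ f (Fin.fromℕ k)
  sum-last {zero}  f _   = +-identityʳ _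
  sum-last {suc k} f f≈0 = trans (+-congʳ (f≈0 zero (s≤s z≤n)))
    (trans (+-identityˡ _) (sum-last (f ∘ suc) (λ i i<k → f≈0 (suc i) (s≤s i<k))))

  open import Algebra.Properties.Semiring.Mult semiring public
    using (×-congʳ; ×-assoc-*; ×1-homo-*; ×-homo-1) renaming (_×_ to _·_)
  import Algebra.Properties.CommutativeSemiring.Binomial commutativeSemiring as Binomial

  ·-via-1 : ∀ m x → m · x ≈ (m · 1#) * x
  ·-via-1 m x = trans (×-congʳ m (sym (*-identityˡ x))) (sym (×-assoc-* m 1# x))

  ^·1≈·1^ : ∀ a k → (a ℕ.^ k) · 1# ≈ (a · 1#) ^ k
  ^·1≈·1^ a zero    = ×-homo-1 1#
  ^·1≈·1^ a (suc k) = trans (×1-homo-* a (a ℕ.^ k)) (*-congˡ (^·1≈·1^ a k))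

  p∣m⇒m·x≈0 : ∀ {p m} → p · 1# ≈ 0# → ∀ x → p ∣ m → m · x ≈ 0#
  p∣m⇒m·x≈0 {p} p·1≈0 x (divides t ≡.refl) = begin
    (t ℕ.* p) · x                 ≈⟨ ·-via-1 (t ℕ.* p) x ⟩
    ((t ℕ.* p) · 1#) * x          ≈⟨ *-congʳ (×1-homo-* t p) ⟩
    ((t · 1#) * (p · 1#)) * x     ≈⟨ *-congʳ (*-congˡ p·1≈0) ⟩
    ((t · 1#) * 0#) * x           ≈⟨ *-congʳ (zeroʳ _) ⟩
    0# * x                        ≈⟨ zeroˡ x ⟩
    0#                            ∎

  PowerAdditive : ℕ → Set (c ⊔ ℓ)
  PowerAdditive e = ∀ x y → (x + y) ^ e ≈ x ^ e + y ^ e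

  PowerAdditive-* : ∀ {d e} → PowerAdditive d → PowerAdditive e → PowerAdditive (d ℕ.* e)
  PowerAdditive-* {d} {e} add-d add-e x y = begin
    (x + y) ^ (d ℕ.* e)          ≈⟨ ^-assocʳ (x + y) d e ⟨
    ((x + y) ^ d) ^ e            ≈⟨ ^-congˡ e (add-d x y) ⟩
    (x ^ d + y ^ d) ^ e          ≈⟨ add-e _ _ ⟩
    (x ^ d) ^ e + (y ^ d) ^ e    ≈⟨ +-cong (^-assocʳ x d e) (^-assocʳ y d e) ⟩
    x ^ (d ℕ.* e) + y ^ (d ℕ.* e) ∎

  PowerAdditive-^ : ∀ {d} → PowerAdditive d → ∀ k → PowerAdditive (d ℕ.^ k)
  PowerAdditive-^ _     zero    x y = trans (*-identityʳ (x + y)) (sym (+-cong (*-identityʳ x) (*-identityʳ y)))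
  PowerAdditive-^ {d} add-d (suc k) = PowerAdditive-* {d} {d ℕ.^ k} add-d (PowerAdditive-^ add-d k)


  -- Frobenius: the inner binomial coefficients of (x + y) ^ p are divisible by p
  ^p-additive : ∀ {p} → Prime p → p · 1# ≈ 0# → PowerAdditive p
  ^p-additive {suc p′} prime-p p·1≈0 x y = begin
    (x + y) ^ p                                        ≈⟨ Binomial.theorem p x y ⟩
    term zero + sum (λ i → term (suc i))               ≈⟨ +-congˡ (sum-last (term ∘ suc) inner≈0) ⟩
    term zero + term (suc (Fin.fromℕ p′))              ≈⟨ +-cong first last ⟩
    y ^ p + x ^ p                                      ≈⟨ +-comm _ _ ⟩
    x ^ p + y ^ p                                      ∎
    where
    p = suc p′
    term = Binomial.binomialTerm x y p
    inner≈0 : ∀ i → toℕ i < p′ → term (suc i) ≈ 0#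
    inner≈0 i i<p′ = p∣m⇒m·x≈0 p·1≈0 _ (prime∣pCk prime-p (s≤s z≤n) (s≤s i<p′))
    first : 1 · (1# * y ^ p) ≈ y ^ p
    first = trans (×-homo-1 _) (*-identityˡ _)
    last : (p choose suc (toℕ (Fin.fromℕ p′))) · (x ^ suc (toℕ (Fin.fromℕ p′)) * y ^ (p′ ℕ.∸ toℕ (Fin.fromℕ p′)))
           ≈ x ^ p
    last rewrite Fin.toℕ-fromℕ p′ | nCn≡1 p | ℕ.n∸n≡0 p′ = trans (×-homo-1 _) (*-identityʳ _)

  geometric-series : ∀ M y → sum {M} (λ i → y ^ toℕ i) * y + 1# ≈ y ^ M + sum {M} (λ i → y ^ toℕ i)
  geometric-series zero    y = trans (+-congʳ (zeroˡ y)) (+-comm 0# 1#)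
  geometric-series (suc M) y = begin
    (1# + sum {M} (λ i → y * y ^ toℕ i)) * y + 1# ≈⟨ +-congʳ (*-congʳ (+-congˡ (*-distribˡ-sum {M} y (λ i → y ^ toℕ i)))) ⟨
    (1# + y * S) * y + 1#                       ≈⟨ step₁ y S ⟩
    y * (S * y + 1#) + 1#                       ≈⟨ +-congʳ (*-congˡ (geometric-series M y)) ⟩
    y * (y ^ M + S) + 1#                        ≈⟨ step₂ y (y ^ M) S ⟩
    y * y ^ M + (1# + y * S)                    ≈⟨ +-congˡ (+-congˡ (*-distribˡ-sum {M} y (λ i → y ^ toℕ i))) ⟩
    y * y ^ M + (1# + sum {M} (λ i → y * y ^ toℕ i)) ∎
    where
    open import Algebra.Solver.Ring.NaturalCoefficients.Default commutativeSemiring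
      using (solve; _:+_; _:*_; _:=_; con)
    S = sum {M} (λ i → y ^ toℕ i)
    step₁ : ∀ y S → (1# + y * S) * y + 1# ≈ y * (S * y + 1#) + 1#
    step₁ = solve 2 (λ y S → (con 1 :+ y :* S) :* y :+ con 1 := y :* (S :* y :+ con 1) :+ con 1) refl
    step₂ : ∀ y P S → y * (P + S) + 1# ≈ y * P + (1# + y * S)
    step₂ = solve 3 (λ y P S → y :* (P :+ S) :+ con 1 := y :* P :+ (con 1 :+ y :* S)) refl

  sum-linear : ∀ {k l} (a : Fin k → Carrier) (f : Fin k → Fin l → Carrier) →
               sum (λ i → sum (λ t → a t * f t i)) ≈ sum (λ t → a t * sum (f t))
  sum-linear {k} {l} a f = trans (∑-comm (λ i t → a t * f t i)) (sum-cong-≋ (λ t → sym (*-distribˡ-sum (a t) (f t))))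

module FiniteField {c ℓ} (F : Field c ℓ) {Q} (card : HasCardinality F Q) where

  open Field F hiding (zero)
  open FieldProperties F
  open HasCardinality card
  open import Algebra.Bundles using (CommutativeMonoid)
  import Algebra.Properties.CommutativeMonoid.Sum as MonoidSum
  open import Algebra.Properties.CommutativeMonoid.Sum *-commutativeMonoid
    using () renaming (sum to product; sum-cong-≋ to product-cong; ∑-distrib-+ to product-distrib-*; sum-remove to product-remove)
  open import Algebra.Properties.Monoid.Sum *-monoid using () renaming (sum-replicate to product-replicate)
  open import Algebra.Properties.Monoid.Sum +-monoid using (sum-replicate)
  open import Data.Fin.Permutation using (Permutation′; permutation)
  open ≈-Reasoning

  index : Carrier → Fin Q
  index x = proj₁ (enum-surj x)

  enum-index : ∀ x → enum (index x) ≈ x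
  enum-index x = proj₂ (enum-surj x)

  index-cong : ∀ {x y} → x ≈ y → index x ≡ index y
  index-cong {x} {y} x≈y = enum-inj _ _ (trans (enum-index x) (trans x≈y (sym (enum-index y))))

  index-enum : ∀ i → index (enum i) ≡ i
  index-enum i = enum-inj _ _ (enum-index (enum i))

  infix 4 _≟_
  _≟_ : ∀ x y → Dec (x ≈ y)
  x ≟ y with index x Fin.≟ index y
  ... | yes i≡j = yes (trans (sym (enum-index x)) (trans (reflexive (≡.cong enum i≡j)) (enum-index y)))
  ... | no  i≢j = no (i≢j ∘ index-cong)

  Q≡1+[Q∸1] : Q ≡ suc (Q ℕ.∸ 1)
  Q≡1+[Q∸1] = nonEmpty (index 0#)
    where
    nonEmpty : ∀ {k} → Fin k → k ≡ suc (k ℕ.∸ 1)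
    nonEmpty {suc k} _ = ≡.refl

  module Reindex (h h⁻¹ : Carrier → Carrier)
                 (h-cong : ∀ {x y} → x ≈ y → h x ≈ h y) (h⁻¹-cong : ∀ {x y} → x ≈ y → h⁻¹ x ≈ h⁻¹ y)
                 (h∘h⁻¹ : ∀ y → h (h⁻¹ y) ≈ y) (h⁻¹∘h : ∀ x → h⁻¹ (h x) ≈ x) where

    π : Permutation′ Q
    π = permutation (λ i → index (h (enum i))) (λ j → index (h⁻¹ (enum j)))
      (λ j → ≡.trans (index-cong (trans (h-cong (enum-index _)) (h∘h⁻¹ _))) (index-enum j))
      (λ i → ≡.trans (index-cong (trans (h⁻¹-cong (enum-index _)) (h⁻¹∘h _))) (index-enum i))

    fold-reindex : ∀ {a ℓ′} (M : CommutativeMonoid a ℓ′) (let module M = CommutativeMonoid M)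
                   (φ : Carrier → M.Carrier) → (∀ {x y} → x ≈ y → φ x M.≈ φ y) →
                   MonoidSum.sum M (φ ∘ enum) M.≈ MonoidSum.sum M (φ ∘ h ∘ enum)
    fold-reindex M φ φ-cong = M.trans (MonoidSum.∑-permute M (φ ∘ enum) π)
                                      (MonoidSum.sum-cong-≋ M (λ i → φ-cong (enum-index (h (enum i)))))
      where module M = CommutativeMonoid M

  Q·x≈0 : ∀ x → Q · x ≈ 0#
  Q·x≈0 x = +-cancelʳ S _ _ (begin
    Q · x + S                       ≈⟨ +-congʳ (sum-replicate Q) ⟨
    sum {Q} (λ _ → x) + S           ≈⟨ ∑-distrib-+ (λ _ → x) enum ⟨
    sum {Q} (λ i → x + enum i)      ≈⟨ fold-reindex +-commutativeMonoid (λ y → y) (λ y≈z → y≈z) ⟨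
    S                               ≈⟨ +-identityˡ S ⟨
    0# + S                          ∎)
    where
    S = sum enum
    open Reindex (x +_) (- x +_) +-congˡ +-congˡ
      (λ y → trans (sym (+-assoc _ _ _)) (trans (+-congʳ (-‿inverseʳ x)) (+-identityˡ y)))
      (λ y → trans (sym (+-assoc _ _ _)) (trans (+-congʳ (-‿inverseˡ x)) (+-identityˡ y)))

  product-nonZero : ∀ {k} (t : Fin k → Carrier) → (∀ i → ¬ t i ≈ 0#) → ¬ product t ≈ 0#
  product-nonZero {zero}  t t≉0 = 1≉0
  product-nonZero {suc k} t t≉0 = *-nonZero (t≉0 zero) (product-nonZero (t ∘ suc) (t≉0 ∘ suc))

  product-all-but-one : ∀ {k x} (t : Fin k → Carrier) z → t z ≈ 1# →
                        (∀ i → ¬ i ≡ z → t i ≈ x) → product t ≈ x ^ (k ℕ.∸ 1)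
  product-all-but-one {suc k} {x} t z tz≈1 t≈x = begin
    product t                                 ≈⟨ product-remove {i = z} t ⟩
    t z * product (λ j → t (Fin.punchIn z j)) ≈⟨ *-cong tz≈1 (product-cong (λ j → t≈x _ (Fin.punchInᵢ≢i z j))) ⟩
    1# * product {k} (λ _ → x)                ≈⟨ *-identityˡ _ ⟩
    product {k} (λ _ → x)                     ≈⟨ product-replicate k ⟩
    x ^ k                                     ∎

  zeroTo1 : Carrier → Carrier
  zeroTo1 y with y ≟ 0#
  ... | yes _ = 1#
  ... | no  _ = y

  zeroTo1-cong : ∀ {y z} → y ≈ z → zeroTo1 y ≈ zeroTo1 z
  zeroTo1-cong {y} {z} y≈z with y ≟ 0# | z ≟ 0#
  ... | yes _   | yes _   = refl
  ... | yes y≈0 | no  z≉0 = ⊥-elim (z≉0 (trans (sym y≈z) y≈0))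
  ... | no  y≉0 | yes z≈0 = ⊥-elim (y≉0 (trans y≈z z≈0))
  ... | no  _   | no  _   = y≈z

  zeroTo1-nonZero : ∀ y → ¬ zeroTo1 y ≈ 0#
  zeroTo1-nonZero y with y ≟ 0#
  ... | yes _   = 1≉0
  ... | no  y≉0 = y≉0

  scaleUnlessZero : Carrier → Carrier → Carrier
  scaleUnlessZero x y with y ≟ 0#
  ... | yes _ = 1#
  ... | no  _ = x

  zeroTo1-* : ∀ {x} y → ¬ x ≈ 0# → zeroTo1 (x * y) ≈ scaleUnlessZero x y * zeroTo1 y
  zeroTo1-* {x} y x≉0 with y ≟ 0# | x * y ≟ 0#
  ... | yes _   | yes _    = sym (*-identityˡ 1#)
  ... | yes y≈0 | no  xy≉0 = ⊥-elim (xy≉0 (trans (*-congˡ y≈0) (zeroʳ x)))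
  ... | no  y≉0 | yes xy≈0 = ⊥-elim (*-nonZero x≉0 y≉0 xy≈0)
  ... | no  _   | no  _    = refl

  -- multiplying by x permutes F; compare the products of all elements, each 0 replaced by 1
  x^[Q∸1]≈1 : ∀ {x} → ¬ x ≈ 0# → x ^ (Q ℕ.∸ 1) ≈ 1#
  x^[Q∸1]≈1 {x} x≉0 = *-cancelˡ (product-nonZero (zeroTo1 ∘ enum) (zeroTo1-nonZero ∘ enum)) (begin
    P * x ^ (Q ℕ.∸ 1)                                     ≈⟨ *-comm P _ ⟩
    x ^ (Q ℕ.∸ 1) * P                                     ≈⟨ *-congʳ scales ⟨
    product {Q} (λ i → scaleUnlessZero x (enum i)) * P
                                                           ≈⟨ product-distrib-* (λ i → scaleUnlessZero x (enum i)) (zeroTo1 ∘ enum) ⟨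
    product {Q} (λ i → scaleUnlessZero x (enum i) * zeroTo1 (enum i))
                                                           ≈⟨ product-cong (λ i → zeroTo1-* (enum i) x≉0) ⟨
    product {Q} (λ i → zeroTo1 (x * enum i))              ≈⟨ fold-reindex *-commutativeMonoid zeroTo1 zeroTo1-cong ⟨
    P                                                      ≈⟨ *-identityʳ P ⟨
    P * 1#                                                 ∎)
    where
    P = product (zeroTo1 ∘ enum)
    open Reindex (x *_) (x ⁻¹⟨ x≉0 ⟩ *_) *-congˡ *-congˡ
      (λ y → trans (sym (*-assoc _ _ _)) (trans (*-congʳ (*-inverseʳ x x≉0)) (*-identityˡ y)))
      (λ y → trans (sym (*-assoc _ _ _)) (trans (*-congʳ (*-inverseˡ x x≉0)) (*-identityˡ y)))
    scaleAt0 : scaleUnlessZero x (enum (index 0#)) ≈ 1#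
    scaleAt0 with enum (index 0#) ≟ 0#
    ... | yes _  = refl
    ... | no  ≉0 = ⊥-elim (≉0 (enum-index 0#))
    scaleElsewhere : ∀ i → ¬ i ≡ index 0# → scaleUnlessZero x (enum i) ≈ x
    scaleElsewhere i i≢ with enum i ≟ 0#
    ... | yes ≈0 = ⊥-elim (i≢ (≡.trans (≡.sym (index-enum i)) (index-cong ≈0)))
    ... | no  _  = refl
    scales : product {Q} (λ i → scaleUnlessZero x (enum i)) ≈ x ^ (Q ℕ.∸ 1)
    scales = product-all-but-one _ (index 0#) scaleAt0 scaleElsewhere

  x^Q≈x : ∀ x → x ^ Q ≈ x
  x^Q≈x x with x ≟ 0#
  ... | yes x≈0 = trans (^-congʳ x Q≡1+[Q∸1]) (trans (*-congʳ x≈0) (trans (zeroˡ _) (sym x≈0)))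
  ... | no  x≉0 = trans (^-congʳ x Q≡1+[Q∸1]) (trans (*-congˡ (x^[Q∸1]≈1 x≉0)) (*-identityʳ x))

  p·1≈0 : ∀ {p N} → Q ≡ p ℕ.^ N → p · 1# ≈ 0#
  p·1≈0 {p} {N} Q≡p^N with p · 1# ≟ 0#
  ... | yes p·1≈0 = p·1≈0
  ... | no  p·1≉0 = ⊥-elim (^-nonZero N p·1≉0 (begin
    (p · 1#) ^ N     ≈⟨ ^·1≈·1^ p N ⟨
    (p ℕ.^ N) · 1#   ≡⟨ ≡.cong (_· 1#) Q≡p^N ⟨
    Q · 1#           ≈⟨ Q·x≈0 1# ⟩
    0#               ∎))

  ^q-additive : ∀ {q n} → IsPrimePower q → Q ≡ q ℕ.^ n → PowerAdditive q
  ^q-additive {q} {n} (p , e , prime-p , _ , q≡p^e) Q≡q^n =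
    ≡.subst PowerAdditive (≡.sym q≡p^e) (PowerAdditive-^ (^p-additive prime-p (p·1≈0 {p} {e ℕ.* n} Q≡p^en)) e)
    where
    Q≡p^en : Q ≡ p ℕ.^ (e ℕ.* n)
    Q≡p^en = ≡.trans Q≡q^n (≡.trans (≡.cong (ℕ._^ n) q≡p^e) (ℕ.^-*-assoc p e n))

module Polynomials {c ℓ} (F : Field c ℓ) where

  open Field F hiding (zero)
  open FieldProperties F
  open import Algebra.Solver.Ring.NaturalCoefficients.Default commutativeSemiring
    using (solve; _:+_; _:*_; _:=_; con)
  open import Data.List.Properties using (length-tabulate)
  open import Data.List.Relation.Unary.All using (All; []; _∷_)
  import Data.List.Relation.Unary.All as All
  open import Data.List.Relation.Unary.All.Properties using (tabulate⁻)
  open import Data.List.Relation.Unary.AllPairs using ([]; _∷_)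
  open import Data.List.Relation.Unary.Unique.Setoid setoid using (Unique)
  open ≈-Reasoning

  -- a coefficient list a₀ ∷ a₁ ∷ … denotes a₀ + a₁ X + …
  ⟦_⟧ : List Carrier → Carrier → Carrier
  ⟦ []     ⟧ x = 0#
  ⟦ a ∷ as ⟧ x = a + x * ⟦ as ⟧ x

  -- the quotient of the division by X - a
  quotient : Carrier → List Carrier → List Carrier
  quotient a []           = []
  quotient a (b ∷ [])     = []
  quotient a (b ∷ b′ ∷ p) = ⟦ b′ ∷ p ⟧ a ∷ quotient a (b′ ∷ p)

  length-quotient : ∀ a b p → length (quotient a (b ∷ p)) ≡ length p
  length-quotient a b []       = ≡.refl
  length-quotient a b (b′ ∷ p) = ≡.cong suc (length-quotient a b′ p)

  -- p(x) = p(a) + (x - a) q(x), with the subtraction moved to the other side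
  division : ∀ a p x → ⟦ p ⟧ x + a * ⟦ quotient a p ⟧ x ≈ ⟦ p ⟧ a + x * ⟦ quotient a p ⟧ x
  division a [] x = trans (+-congˡ (zeroʳ a)) (sym (+-congˡ (zeroʳ x)))
  division a (b ∷ []) x =
    solve 3 (λ a b x → (b :+ x :* con 0) :+ a :* con 0 := (b :+ a :* con 0) :+ x :* con 0) refl a b x
  division a (b ∷ b′ ∷ p) x = begin
    (b + x * Px) + a * (Pa + x * D)   ≈⟨ rearrange b x a Px Pa D ⟩
    (b + a * Pa) + x * (Px + a * D)   ≈⟨ +-congˡ (*-congˡ (division a (b′ ∷ p) x)) ⟩
    (b + a * Pa) + x * (Pa + x * D)   ∎
    where
    Px = ⟦ b′ ∷ p ⟧ x
    Pa = ⟦ b′ ∷ p ⟧ a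
    D = ⟦ quotient a (b′ ∷ p) ⟧ x
    rearrange : ∀ b x a Px Pa D → (b + x * Px) + a * (Pa + x * D) ≈ (b + a * Pa) + x * (Px + a * D)
    rearrange = solve 6 (λ b x a Px Pa D →
      (b :+ x :* Px) :+ a :* (Pa :+ x :* D) := (b :+ a :* Pa) :+ x :* (Px :+ a :* D)) refl

  quotient-root : ∀ {a r} p → ⟦ p ⟧ a ≈ 0# → ⟦ p ⟧ r ≈ 0# → ¬ r ≈ a → ⟦ quotient a p ⟧ r ≈ 0#
  quotient-root {a} {r} p pa≈0 pr≈0 r≉a = x*z≈y*z⇒z≈0 r≉a (begin
    r * D             ≈⟨ +-identityˡ _ ⟨
    0# + r * D        ≈⟨ +-congʳ pa≈0 ⟨
    ⟦ p ⟧ a + r * D   ≈⟨ division a p r ⟨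
    ⟦ p ⟧ r + a * D   ≈⟨ +-congʳ pr≈0 ⟩
    0# + a * D        ≈⟨ +-identityˡ _ ⟩
    a * D             ∎)
    where D = ⟦ quotient a p ⟧ r

  quotient-zero : ∀ {a} b p → ⟦ b ∷ p ⟧ a ≈ 0# → All (_≈ 0#) (quotient a (b ∷ p)) → All (_≈ 0#) (b ∷ p)
  quotient-zero {a} b [] root _ = trans (sym (trans (+-congˡ (zeroʳ a)) (+-identityʳ b))) root ∷ []
  quotient-zero {a} b (b′ ∷ p) root (p′a≈0 ∷ q≈0) = b≈0 ∷ quotient-zero b′ p p′a≈0 q≈0
    where
    b≈0 : b ≈ 0#
    b≈0 = begin
      b                       ≈⟨ +-identityʳ b ⟨
      b + 0#                  ≈⟨ +-congˡ (trans (*-congˡ p′a≈0) (zeroʳ a)) ⟨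
      b + a * ⟦ b′ ∷ p ⟧ a    ≈⟨ root ⟩
      0#                      ∎

  root-bound : ∀ p rs → Unique rs → All (λ r → ⟦ p ⟧ r ≈ 0#) rs → length p ≤ length rs → All (_≈ 0#) p
  root-bound []      rs        _              _             _         = []
  root-bound (b ∷ p) (a ∷ rs) (a≉rs ∷ unique) (pa≈0 ∷ roots) (s≤s len) =
    quotient-zero b p pa≈0 (root-bound (quotient a (b ∷ p)) rs unique
      (All.zipWith (λ (a≉r , pr≈0) → quotient-root (b ∷ p) pa≈0 pr≈0 (a≉r ∘ sym)) (a≉rs , roots))
      (≡.subst (_≤ length rs) (≡.sym (length-quotient a b p)) len))

  ⟦tabulate⟧ : ∀ {n} (a : Fin n → Carrier) x → ⟦ tabulate a ⟧ x ≈ sum (λ k → a k * x ^ toℕ k)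
  ⟦tabulate⟧ {zero}  a x = refl
  ⟦tabulate⟧ {suc n} a x = +-cong (sym (*-identityʳ (a zero))) (begin
    x * ⟦ tabulate (a ∘ suc) ⟧ x                 ≈⟨ *-congˡ (⟦tabulate⟧ (a ∘ suc) x) ⟩
    x * sum {n} (λ k → a (suc k) * x ^ toℕ k)    ≈⟨ *-distribˡ-sum x (λ k → a (suc k) * x ^ toℕ k) ⟩
    sum {n} (λ k → x * (a (suc k) * x ^ toℕ k))  ≈⟨ sum-cong-≋ (λ k → x*[y*z]≈y*[x*z] x (a (suc k)) _) ⟩
    sum {n} (λ k → a (suc k) * (x * x ^ toℕ k))  ∎)

  sparse : ∀ {T} → (Fin T → ℕ) → (Fin T → Carrier) → Carrier → Carrier
  sparse e a x = sum (λ t → a t * x ^ e t)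

  module _ {T D} (e : Fin T → ℕ) (a : Fin T → Carrier)
           (e-injective : ∀ s t → e s ≡ e t → s ≡ t) (e≤D : ∀ t → e t ≤ D) where

    termAt : Fin (suc D) → Fin T → Carrier
    termAt k t with e t ℕ.≟ toℕ k
    ... | yes _ = a t
    ... | no  _ = 0#

    dense : Fin (suc D) → Carrier
    dense k = sum (termAt k)

    degree : Fin T → Fin (suc D)
    degree t = Fin.fromℕ< (s≤s (e≤D t))

    termAt-≡ : ∀ {k t} → e t ≡ toℕ k → termAt k t ≈ a t
    termAt-≡ {k} {t} eq with e t ℕ.≟ toℕ k
    ... | yes _  = refl
    ... | no  ne = ⊥-elim (ne eq)

    termAt-≢ : ∀ {k t} → ¬ e t ≡ toℕ k → termAt k t ≈ 0#
    termAt-≢ {k} {t} ne with e t ℕ.≟ toℕ k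
    ... | yes eq = ⊥-elim (ne eq)
    ... | no  _  = refl

    toℕ-degree : ∀ t → toℕ (degree t) ≡ e t
    toℕ-degree t = Fin.toℕ-fromℕ< (s≤s (e≤D t))

    dense-degree : ∀ s → dense (degree s) ≈ a s
    dense-degree s = trans (sum-δ s (λ t t≢s → termAt-≢ (λ eq → t≢s (e-injective t s (≡.trans eq (toℕ-degree s))))))
                           (termAt-≡ (≡.sym (toℕ-degree s)))

    termAt-off-degree : ∀ t k → ¬ k ≡ degree t → termAt k t ≈ 0#
    termAt-off-degree t k k≢ = termAt-≢ (λ eq → k≢ (Fin.toℕ-injective (≡.trans (≡.sym eq) (≡.sym (toℕ-degree t)))))

    ⟦dense⟧ : ∀ x → ⟦ tabulate dense ⟧ x ≈ sparse e a x
    ⟦dense⟧ x = begin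
      ⟦ tabulate dense ⟧ x                                   ≈⟨ ⟦tabulate⟧ dense x ⟩
      sum (λ k → sum (termAt k) * x ^ toℕ k)                 ≈⟨ sum-cong-≋ (λ k → *-distribʳ-sum (x ^ toℕ k) (termAt k)) ⟩
      sum (λ k → sum (λ t → termAt k t * x ^ toℕ k))         ≈⟨ ∑-comm (λ k t → termAt k t * x ^ toℕ k) ⟩
      sum (λ t → sum (λ k → termAt k t * x ^ toℕ k))         ≈⟨ sum-cong-≋ (λ t → sum-δ (degree t) (λ k k≢ →
                                                                  trans (*-congʳ (termAt-off-degree t k k≢)) (zeroˡ (x ^ toℕ k)))) ⟩
      sum (λ t → termAt (degree t) t * x ^ toℕ (degree t))   ≈⟨ sum-cong-≋ (λ t →
                                                                  *-cong (termAt-≡ (≡.sym (toℕ-degree t))) (^-congʳ x (toℕ-degree t))) ⟩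
      sparse e a x                                           ∎

    sparse-root-bound : ∀ rs → Unique rs → All (λ r → sparse e a r ≈ 0#) rs → suc D ≤ length rs → ∀ t → a t ≈ 0#
    sparse-root-bound rs unique roots len t = trans (sym (dense-degree t)) (tabulate⁻ {f = dense} dense≈0 (degree t))
      where
      dense≈0 : All (_≈ 0#) (tabulate dense)
      dense≈0 = root-bound (tabulate dense) rs unique (All.map (λ {r} → trans (⟦dense⟧ r)) roots)
                  (≡.subst (_≤ length rs) (≡.sym (length-tabulate dense)) len)

    sparse-root-count : ∀ {t} → ¬ a t ≈ 0# → ∀ rs → Unique rs → All (λ r → sparse e a r ≈ 0#) rs → length rs ≤ D
    sparse-root-count at≉0 rs unique roots with suc D ℕ.≤? length rs
    ... | yes len = ⊥-elim (at≉0 (sparse-root-bound rs unique roots len _))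
    ... | no  len = ℕ.≤-pred (ℕ.≰⇒> len)

module Subfield {c ℓ} (F : Field c ℓ) {q n} (q-primePower : IsPrimePower q) (1≤n : 1 ≤ n)
                (card : HasCardinality F (q ℕ.^ n)) where

  open Field F hiding (zero)
  open FieldProperties F
  open FiniteField F card hiding (^q-additive)
  open HasCardinality card

  2≤q : 2 ≤ q
  2≤q = primePower⇒2≤ q-primePower

  ^q-additive : PowerAdditive q
  ^q-additive = FiniteField.^q-additive F card {n = n} q-primePower ≡.refl

  ^q^j-additive : ∀ j → PowerAdditive (q ℕ.^ j)
  ^q^j-additive = PowerAdditive-^ ^q-additive

  instance
    q≢0 : ℕ.NonZero q
    q≢0 = ℕ.>-nonZero (ℕ.≤-trans (s≤s z≤n) 2≤q)

  0^q≈0 : 0# ^ q ≈ 0#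
  0^q≈0 = trans (^-congʳ 0# (≡.sym (ℕ.suc-pred q))) (zeroˡ _)

  InFq : Carrier → Set ℓ
  InFq x = x ^ q ≈ x

  InFq? : ∀ x → Dec (InFq x)
  InFq? x = x ^ q ≟ x

  InFq-resp : ∀ {x y} → x ≈ y → InFq x → InFq y
  InFq-resp x≈y x∈ = trans (^-congˡ q (sym x≈y)) (trans x∈ x≈y)

  InFq-0 : InFq 0#
  InFq-0 = 0^q≈0

  InFq-1 : InFq 1#
  InFq-1 = 1^n≈1 q

  InFq-+ : ∀ {x y} → InFq x → InFq y → InFq (x + y)
  InFq-+ x∈ y∈ = trans (^q-additive _ _) (+-cong x∈ y∈)

  InFq-* : ∀ {x y} → InFq x → InFq y → InFq (x * y)
  InFq-* x∈ y∈ = trans (^-distrib-* _ _ q) (*-cong x∈ y∈)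

  InFq-- : ∀ {x} → InFq x → InFq (- x)
  InFq-- {x} x∈ = trans (+-inverseʳ-unique (x ^ q) _ (begin
    x ^ q + (- x) ^ q   ≈⟨ ^q-additive x (- x) ⟨
    (x - x) ^ q         ≈⟨ ^-congˡ q (-‿inverseʳ x) ⟩
    0# ^ q              ≈⟨ 0^q≈0 ⟩
    0#                  ∎)) (-‿cong x∈)
    where open ≈-Reasoning

  InFq-⁻¹ : ∀ {x} (x≉0 : ¬ x ≈ 0#) → InFq x → InFq (x ⁻¹⟨ x≉0 ⟩)
  InFq-⁻¹ {x} x≉0 x∈ = *-cancelˡ x≉0 (begin
    x * (x ⁻¹⟨ x≉0 ⟩) ^ q       ≈⟨ *-congʳ x∈ ⟨
    x ^ q * (x ⁻¹⟨ x≉0 ⟩) ^ q   ≈⟨ ^-distrib-* x _ q ⟨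
    (x * x ⁻¹⟨ x≉0 ⟩) ^ q       ≈⟨ ^-congˡ q (*-inverseʳ x x≉0) ⟩
    1# ^ q                      ≈⟨ 1^n≈1 q ⟩
    1#                          ≈⟨ *-inverseʳ x x≉0 ⟨
    x * x ⁻¹⟨ x≉0 ⟩             ∎)
    where open ≈-Reasoning

  InFq-^q^j : ∀ {x} → InFq x → ∀ j → x ^ (q ℕ.^ j) ≈ x
  InFq-^q^j x∈ zero    = *-identityʳ _
  InFq-^q^j {x} x∈ (suc j) = begin
    x ^ (q ℕ.* q ℕ.^ j)   ≈⟨ ^-assocʳ x q (q ℕ.^ j) ⟨
    (x ^ q) ^ (q ℕ.^ j)   ≈⟨ ^-congˡ (q ℕ.^ j) x∈ ⟩
    x ^ (q ℕ.^ j)         ≈⟨ InFq-^q^j x∈ j ⟩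
    x                     ∎
    where open ≈-Reasoning

  InFq-sum : ∀ {k} (g : Fin k → Carrier) → (∀ t → InFq (g t)) → InFq (sum g)
  InFq-sum {zero}  g _   = InFq-0
  InFq-sum {suc k} g g∈ = InFq-+ (g∈ zero) (InFq-sum (g ∘ suc) (g∈ ∘ suc))

  InFq-isSubfield : IsSubfield InFq
  InFq-isSubfield = record
    { K-0 = InFq-0 ; K-1 = InFq-1 ; K-+ = InFq-+ ; K-* = InFq-* ; K-- = InFq-- ; K-⁻¹ = InFq-⁻¹ }

  open Polynomials F using (sparse; sparse-root-count)
  open import Data.List.Relation.Unary.All using (All)
  import Data.List.Relation.Unary.All as All
  open import Data.List.Relation.Unary.All.Properties using (all-filter)
  import Data.List.Relation.Unary.Unique.Setoid.Properties as Unique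
  open import Data.List.Relation.Unary.Unique.Setoid setoid using (Unique)
  import Data.List.Relation.Unary.Any as Any
  open import Data.List.Relation.Unary.Any.Properties using (lookup-index)
  open import Data.List.Membership.Setoid setoid using (_∈_)
  open import Data.List.Membership.Setoid.Properties using (∈-filter⁺; ∈-resp-≈; ∈-tabulate⁺)
  open import Data.List.Membership.Propositional.Properties using (∈-lookup)
  open import Data.List.Properties using (length-tabulate)

  elements : List Carrier
  elements = tabulate enum

  elements-unique : Unique elements
  elements-unique = Unique.tabulate⁺ setoid (λ {i} {j} → enum-inj i j)

  fixedElements movedElements : List Carrier
  fixedElements = filter InFq? elements
  movedElements = filter (¬? ∘ InFq?) elements

  -- the elements of F_q are roots of X^q - X
  fixedElements-count : length fixedElements ≤ q
  fixedElements-count = sparse-root-count exponent coefficient exponent-injective exponent≤q {zero} 1≉0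
    fixedElements (Unique.filter⁺ setoid InFq? elements-unique) (All.map root (all-filter InFq? elements))
    where
    open ≈-Reasoning
    exponent : Fin 2 → ℕ
    exponent zero       = q
    exponent (suc zero) = 1
    coefficient : Fin 2 → Carrier
    coefficient zero       = 1#
    coefficient (suc zero) = - 1#
    q≢1 : ¬ q ≡ 1
    q≢1 q≡1 = ℕ.<-irrefl (≡.sym q≡1) 2≤q
    exponent-injective : ∀ s t → exponent s ≡ exponent t → s ≡ t
    exponent-injective zero       zero       _  = ≡.refl
    exponent-injective zero       (suc zero) eq = ⊥-elim (q≢1 eq)
    exponent-injective (suc zero) zero       eq = ⊥-elim (q≢1 (≡.sym eq))
    exponent-injective (suc zero) (suc zero) _  = ≡.refl
    exponent≤q : ∀ t → exponent t ≤ q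
    exponent≤q zero       = ℕ.≤-refl
    exponent≤q (suc zero) = ℕ.≤-trans (s≤s z≤n) 2≤q
    root : ∀ {x} → InFq x → sparse exponent coefficient x ≈ 0#
    root {x} x∈ = begin
      1# * x ^ q + (- 1# * x ^ 1 + 0#)   ≈⟨ +-cong (*-identityˡ _) (trans (+-identityʳ _) (-1*x≈-x _)) ⟩
      x ^ q - x ^ 1                      ≈⟨ +-cong x∈ (-‿cong (*-identityʳ x)) ⟩
      x - x                              ≈⟨ -‿inverseʳ x ⟩
      0#                                 ∎

  M : ℕ
  M = geometric q n

  instance
    M≢0 : ℕ.NonZero M
    M≢0 = geometric-nonZero q n 1≤n

  Q∸1≡pred[q]*M : q ℕ.^ n ℕ.∸ 1 ≡ ℕ.pred q ℕ.* M
  Q∸1≡pred[q]*M = ≡.trans (≡.cong (ℕ._∸ 1) (≡.sym (pred[q]*geometric+1≡q^n q n))) (ℕ.m+n∸n≡m _ 1)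

  -- for x ∉ F_q, y = x^(q-1) ≉ 1 and y^M = x^(Q-1) = 1, so y is a root of 1 + Y + … + Y^(M-1)
  movedElements-count : length movedElements ≤ ℕ.pred q ℕ.* ℕ.pred M
  movedElements-count = sparse-root-count exponent (λ _ → 1#) exponent-injective exponent≤ {Fin.fromℕ< (ℕ.>-nonZero⁻¹ M)} 1≉0
    movedElements (Unique.filter⁺ setoid (¬? ∘ InFq?) elements-unique)
    (All.map root (all-filter (¬? ∘ InFq?) elements))
    where
    open ≈-Reasoning
    instance
      pred[q]≢0 : ℕ.NonZero (ℕ.pred q)
      pred[q]≢0 = ℕ.>-nonZero (ℕ.pred-mono-≤ 2≤q)
    exponent : Fin M → ℕ
    exponent i = ℕ.pred q ℕ.* toℕ i
    exponent-injective : ∀ s t → exponent s ≡ exponent t → s ≡ t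
    exponent-injective s t eq = Fin.toℕ-injective (ℕ.*-cancelˡ-≡ (toℕ s) (toℕ t) (ℕ.pred q) eq)
    exponent≤ : ∀ t → exponent t ≤ ℕ.pred q ℕ.* ℕ.pred M
    exponent≤ t = ℕ.*-monoʳ-≤ (ℕ.pred q) (ℕ.≤-pred (≡.subst (toℕ t <_) (≡.sym (ℕ.suc-pred M)) (Fin.toℕ<n t)))
    root : ∀ {x} → ¬ InFq x → sparse exponent (λ _ → 1#) x ≈ 0#
    root {x} x∉ = trans sparse≈S (x*z≈y*z⇒z≈0 y≉1 (begin
      y * S              ≈⟨ *-comm y S ⟩
      S * y              ≈⟨ +-cancelʳ 1# _ _ (trans (geometric-series M y) (trans (+-congʳ y^M≈1) (+-comm 1# S))) ⟩
      S                  ≈⟨ *-identityˡ S ⟨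
      1# * S             ∎))
      where
      x≉0 : ¬ x ≈ 0#
      x≉0 x≈0 = x∉ (InFq-resp (sym x≈0) InFq-0)
      y = x ^ ℕ.pred q
      S = sum {M} (λ i → y ^ toℕ i)
      y≉1 : ¬ y ≈ 1#
      y≉1 y≈1 = x∉ (trans (^-congʳ x (≡.sym (ℕ.suc-pred q))) (trans (*-congˡ y≈1) (*-identityʳ x)))
      y^M≈1 : y ^ M ≈ 1#
      y^M≈1 = begin
        y ^ M                     ≈⟨ ^-assocʳ x (ℕ.pred q) M ⟩
        x ^ (ℕ.pred q ℕ.* M)      ≡⟨ ≡.cong (x ^_) Q∸1≡pred[q]*M ⟨
        x ^ (q ℕ.^ n ℕ.∸ 1)       ≈⟨ x^[Q∸1]≈1 x≉0 ⟩
        1#                        ∎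
      sparse≈S : sparse exponent (λ _ → 1#) x ≈ S
      sparse≈S = sum-cong-≋ {M} (λ i → trans (*-identityˡ _) (sym (^-assocʳ x (ℕ.pred q) (toℕ i))))

  |Fq| : ℕ
  |Fq| = length fixedElements

  |Fq|≡q : |Fq| ≡ q
  |Fq|≡q = ℕ.≤-antisym fixedElements-count (ℕ.+-cancelʳ-≤ (length movedElements) q |Fq| (begin
    q ℕ.+ length movedElements                  ≤⟨ ℕ.+-monoʳ-≤ q movedElements-count ⟩
    q ℕ.+ ℕ.pred q ℕ.* ℕ.pred M                 ≡⟨ ℕ.+-comm q _ ⟩
    ℕ.pred q ℕ.* ℕ.pred M ℕ.+ q                 ≡⟨ pred[q]*M+1≡pred[q]*pred[M]+q q M ⟨
    ℕ.pred q ℕ.* M ℕ.+ 1                        ≡⟨ pred[q]*geometric+1≡q^n q n ⟩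
    q ℕ.^ n                                     ≡⟨ length-tabulate enum ⟨
    length elements                             ≡⟨ length-filter+length-filter¬ InFq? elements ⟨
    |Fq| ℕ.+ length movedElements               ∎))
    where open ℕ.≤-Reasoning

  elementFq : Fin |Fq| → Carrier
  elementFq = lookup fixedElements

  elementFq-InFq : ∀ i → InFq (elementFq i)
  elementFq-InFq i = All.lookup (all-filter InFq? elements) (∈-lookup i)

  elementFq-injective : ∀ i j → elementFq i ≈ elementFq j → i ≡ j
  elementFq-injective = lookup-injective setoid (Unique.filter⁺ setoid InFq? elements-unique)

  elementFq-surjective : ∀ x → InFq x → Σ (Fin |Fq|) λ i → elementFq i ≈ x
  elementFq-surjective x x∈ = Any.index x∈fixed , sym (lookup-index x∈fixed)
    where
    x∈fixed : x ∈ fixedElements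
    x∈fixed = ∈-filter⁺ setoid InFq? (InFq-resp) (∈-resp-≈ setoid (enum-index x) (∈-tabulate⁺ setoid (index x))) x∈

  Fq-enumeration : Enumeration _≈_ InFq |Fq|
  Fq-enumeration = record
    { element = elementFq ; element-∈ = elementFq-InFq
    ; element-injective = elementFq-injective ; element-surjective = elementFq-surjective }

module LinearAlgebra {c ℓ} (F : Field c ℓ) {Q} (card : HasCardinality F Q) where

  open Field F hiding (zero)
  open FieldProperties F
  open FiniteField F card using (_≟_)
  open HasCardinality card
  open ≈-Reasoning
  open import Data.Vec.Functional using () renaming (_∷_ to _∷ᵛ_; [] to []ᵛ)
  import Relation.Nullary.Decidable as Dec

  Vector : ℕ → Set c
  Vector N = Fin N → Carrier

  infix 4 _≈ᵛ_
  _≈ᵛ_ : ∀ {N} → Vector N → Vector N → Set ℓ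
  u ≈ᵛ v = ∀ i → u i ≈ v i

  ≈ᵛ-sym : ∀ {N} {u v : Vector N} → u ≈ᵛ v → v ≈ᵛ u
  ≈ᵛ-sym u≈v i = sym (u≈v i)

  ≈ᵛ-trans : ∀ {N} {u v w : Vector N} → u ≈ᵛ v → v ≈ᵛ w → u ≈ᵛ w
  ≈ᵛ-trans u≈v v≈w i = trans (u≈v i) (v≈w i)

  _≟ᵛ_ : ∀ {N} (u v : Vector N) → Dec (u ≈ᵛ v)
  u ≟ᵛ v = Fin.all? (λ i → u i ≟ v i)

  allScalars : Enumeration _≈_ (λ _ → ⊤) Q
  allScalars = record
    { element = enum ; element-∈ = λ _ → tt ; element-injective = enum-inj ; element-surjective = λ x _ → enum-surj x }

  allVectors : ∀ N → Enumeration _≈ᵛ_ (λ (v : Vector N) → ∀ i → ⊤) (Q ℕ.^ N)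
  allVectors = enumeration-→ allScalars

  search-in : ∀ {N p₁ p₂} {S : Vector N → Set p₁} {size} → Enumeration _≈ᵛ_ S size →
              (P : Vector N → Set p₂) → (∀ {u v} → u ≈ᵛ v → P u → P v) → (∀ v → Dec (P v)) →
              Dec (Σ (Vector N) λ v → S v × P v)
  search-in E P P-resp P? with Fin.any? (λ i → P? (element i))
    where open Enumeration E
  ... | yes (i , Pi) = yes (_ , element-∈ i , Pi)
    where open Enumeration E
  ... | no  none     = no λ (v , v∈ , Pv) → let (i , i≈v) = element-surjective v v∈ in none (i , P-resp (≈ᵛ-sym i≈v) Pv)
    where open Enumeration E

  search : ∀ {N p} (P : Vector N → Set p) → (∀ {u v} → u ≈ᵛ v → P u → P v) → (∀ v → Dec (P v)) →
           Dec (Σ (Vector N) P)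
  search {N} P P-resp P? = Dec.map′ (λ (v , _ , Pv) → v , Pv) (λ (v , Pv) → v , (λ _ → tt) , Pv)
                                   (search-in (allVectors N) P P-resp P?)

  module _ {d e p₁ p₂} {S₁ : Vector d → Set p₁} {S₂ : Vector e → Set p₂} {m n}
           (X : Enumeration _≈ᵛ_ S₁ m) (Y : Enumeration _≈ᵛ_ S₂ n)
           (h : Vector d → Vector e) (h-∈ : ∀ a → S₁ a → S₂ (h a))
           (h-injective : ∀ a b → S₁ a → S₁ b → h a ≈ᵛ h b → a ≈ᵛ b) where

    private
      module X = Enumeration X
      module Y = Enumeration Y

      code : Fin m → Fin n
      code i = proj₁ (Y.element-surjective (h (X.element i)) (h-∈ _ (X.element-∈ i)))

      code-correct : ∀ i → Y.element (code i) ≈ᵛ h (X.element i)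
      code-correct i = proj₂ (Y.element-surjective (h (X.element i)) (h-∈ _ (X.element-∈ i)))

      code-injective : ∀ i j → code i ≡ code j → i ≡ j
      code-injective i j eq = X.element-injective i j (h-injective _ _ (X.element-∈ i) (X.element-∈ j)
        (≈ᵛ-trans (≈ᵛ-sym (code-correct i)) (≡.subst (λ k → Y.element k ≈ᵛ _) (≡.sym eq) (code-correct j))))

    injection-size : m ≤ n
    injection-size = Fin.injective⇒≤ (λ {i} {j} → code-injective i j)

    injection-onto : m ≡ n → ∀ v → S₂ v → Σ (Vector d) λ a → S₁ a × h a ≈ᵛ v
    injection-onto m≡n v v∈
      with (j , j≈v) ← Y.element-surjective v v∈
      with (i , code-i≡j) ← injective⇒surjective m≡n code code-injective j =
      X.element i , X.element-∈ i ,
      ≈ᵛ-trans (≈ᵛ-sym (code-correct i)) (≡.subst (λ k → Y.element k ≈ᵛ v) (≡.sym code-i≡j) j≈v)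

  module Span {k} {K : Carrier → Set k} (K-subfield : IsSubfield K) {s} (K-enumeration : Enumeration _≈_ K s) where

    open IsSubfield K-subfield

    Scalars : ∀ {d} → Vector d → Set k
    Scalars a = ∀ t → K (a t)

    combination : ∀ {d N} → Vector d → (Fin d → Vector N) → Vector N
    combination a G i = sum (λ t → a t * G t i)

    combination-congˡ : ∀ {d N} {a b : Vector d} (G : Fin d → Vector N) → a ≈ᵛ b → combination a G ≈ᵛ combination b G
    combination-congˡ G a≈b i = sum-cong-≋ (λ t → *-congʳ (a≈b t))

    combination-congʳ : ∀ {d N} (a : Vector d) {G G′ : Fin d → Vector N} → (∀ t → G t ≈ᵛ G′ t) →
                        combination a G ≈ᵛ combination a G′
    combination-congʳ a G≈G′ i = sum-cong-≋ (λ t → *-congˡ (G≈G′ t i))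

    combination-* : ∀ {d N} x (a : Vector d) (G : Fin d → Vector N) →
                    combination (λ t → x * a t) G ≈ᵛ (λ i → x * combination a G i)
    combination-* x a G i = trans (sum-cong-≋ (λ t → *-assoc x (a t) (G t i))) (sym (*-distribˡ-sum x (λ t → a t * G t i)))

    combination-- : ∀ {d N} (a b : Vector d) (G : Fin d → Vector N) →
                    combination (λ t → a t - b t) G ≈ᵛ (λ i → combination a G i - combination b G i)
    combination-- a b G i = begin
      sum (λ t → (a t - b t) * G t i)                   ≈⟨ sum-cong-≋ (λ t → [y-z]x≈yx-zx (G t i) (a t) (b t)) ⟩
      sum (λ t → a t * G t i - b t * G t i)             ≈⟨ ∑-distrib-+ (λ t → a t * G t i) (λ t → - (b t * G t i)) ⟩
      combination a G i + sum (λ t → - (b t * G t i))   ≈⟨ +-congˡ (sum-neg (λ t → b t * G t i)) ⟩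
      combination a G i - combination b G i             ∎

    Independent : ∀ {d N} → (Fin d → Vector N) → Set (c ⊔ ℓ ⊔ k)
    Independent G = ∀ a → Scalars a → combination a G ≈ᵛ (λ _ → 0#) → ∀ t → a t ≈ 0#

    InSpan : ∀ {d N} → (Fin d → Vector N) → Vector N → Set (c ⊔ ℓ ⊔ k)
    InSpan {d} G v = Σ (Vector d) λ a → Scalars a × v ≈ᵛ combination a G

    independent⇒injective : ∀ {d N} {G : Fin d → Vector N} → Independent G → ∀ {a b} → Scalars a → Scalars b →
                            combination a G ≈ᵛ combination b G → a ≈ᵛ b
    independent⇒injective {G = G} independent {a} {b} a∈ b∈ eq t = x∙y⁻¹≈ε⇒x≈y (a t) (b t)
      (independent (λ t → a t - b t) (λ t → K-+ (a∈ t) (K-- (b∈ t)))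
        (λ i → trans (combination-- a b G i) (x≈y⇒x∙y⁻¹≈ε (eq i))) t)

    scalarVectors : ∀ d → Enumeration _≈ᵛ_ (Scalars {d}) (s ℕ.^ d)
    scalarVectors = enumeration-→ K-enumeration

    InSpan? : ∀ {d N} (G : Fin d → Vector N) v → Dec (InSpan G v)
    InSpan? {d} G v = search-in (scalarVectors d) (λ a → v ≈ᵛ combination a G)
                        (λ a≈b v≈ → ≈ᵛ-trans v≈ (combination-congˡ G a≈b)) (λ a → v ≟ᵛ combination a G)

    independent-size : ∀ {d N} {G : Fin d → Vector N} → Independent G → s ℕ.^ d ≤ Q ℕ.^ N
    independent-size {d} {N} {G} independent = injection-size (scalarVectors d) (allVectors N)
      (λ a → combination a G) (λ _ _ _ → tt) (λ _ _ a∈ b∈ → independent⇒injective independent a∈ b∈)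

    2≤s : 2 ≤ s
    2≤s = distinct⇒2≤ (index K-0) (index K-1) (λ eq → 0≉1 (trans (sym (element-index K-0))
                                                  (trans (reflexive (≡.cong element eq)) (element-index K-1))))
      where
      open Enumeration K-enumeration
      index : ∀ {x} → K x → Fin s
      index x∈ = proj₁ (element-surjective _ x∈)
      element-index : ∀ {x} (x∈ : K x) → element (index x∈) ≈ x
      element-index x∈ = proj₂ (element-surjective _ x∈)
      distinct⇒2≤ : ∀ {n} (i j : Fin n) → ¬ i ≡ j → 2 ≤ n
      distinct⇒2≤ {1}           zero zero i≢j = ⊥-elim (i≢j ≡.refl)
      distinct⇒2≤ {suc (suc n)} _    _    _   = s≤s (s≤s z≤n)

    independent-∷ : ∀ {d N} {G : Fin d → Vector N} {v} → Independent G → ¬ InSpan G v → Independent (v ∷ᵛ G)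
    independent-∷ {d} {N} {G} {v} independent v∉ a a∈ a·[v∷ᵛG]≈0 = a≈0
      where
      a′ : Vector d
      a′ t = a (suc t)
      a₀≈0 : a zero ≈ 0#
      a₀≈0 with a zero ≟ 0#
      ... | yes a₀≈0 = a₀≈0
      ... | no  a₀≉0 = ⊥-elim (v∉ ((λ t → - (a zero ⁻¹⟨ a₀≉0 ⟩) * a′ t) ,
                                    (λ t → K-* (K-- (K-⁻¹ a₀≉0 (a∈ zero))) (a∈ (suc t))) , v≈))
        where
        b = a zero ⁻¹⟨ a₀≉0 ⟩
        v≈ : v ≈ᵛ combination (λ t → - b * a′ t) G
        v≈ i = begin
          v i                              ≈⟨ *-identityˡ (v i) ⟨
          1# * v i                         ≈⟨ *-congʳ (*-inverseˡ (a zero) a₀≉0) ⟨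
          (b * a zero) * v i               ≈⟨ *-assoc b (a zero) (v i) ⟩
          b * (a zero * v i)               ≈⟨ *-congˡ (+-inverseˡ-unique _ _ (a·[v∷ᵛG]≈0 i)) ⟩
          b * - combination a′ G i         ≈⟨ -‿distribʳ-* b _ ⟨
          - (b * combination a′ G i)       ≈⟨ -‿distribˡ-* b _ ⟩
          - b * combination a′ G i         ≈⟨ combination-* (- b) a′ G i ⟨
          combination (λ t → - b * a′ t) G i ∎
      a′≈0 : ∀ t → a′ t ≈ 0#
      a′≈0 = independent a′ (a∈ ∘ suc) (λ i → trans (sym (+-identityˡ _))
               (trans (+-congʳ (sym (trans (*-congʳ a₀≈0) (zeroˡ (v i))))) (a·[v∷ᵛG]≈0 i)))
      a≈0 : ∀ t → a t ≈ 0#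
      a≈0 zero    = a₀≈0
      a≈0 (suc t) = a′≈0 t

    record Basis {p N} (P : Vector N → Set p) {d} (G : Fin d → Vector N) : Set (c ⊔ ℓ ⊔ k ⊔ p) where
      field
        ∈P          : ∀ t → P (G t)
        independent : Independent G
        spans       : ∀ v → P v → InSpan G v

    -- greedy extension; an independent family has fewer than s ^ d ≤ Q ^ N members, so Q ^ N steps suffice
    basis : ∀ {p N} (P : Vector N → Set p) → (∀ {u v} → u ≈ᵛ v → P u → P v) → (∀ v → Dec (P v)) →
            Σ ℕ λ d → Σ (Fin d → Vector N) (Basis P)
    basis {N = N} P P-resp P? = extend (suc (Q ℕ.^ N)) {0} (λ ()) (λ ()) (λ _ _ _ ()) ≡.refl
      where
      InSpan-resp : ∀ {d} (G : Fin d → Vector N) {u v} → u ≈ᵛ v → InSpan G u → InSpan G v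
      InSpan-resp G u≈v (a , a∈ , u≈) = a , a∈ , ≈ᵛ-trans (≈ᵛ-sym u≈v) u≈

      extend : ∀ fuel {d} (G : Fin d → Vector N) → (∀ t → P (G t)) → Independent G → d ℕ.+ fuel ≡ suc (Q ℕ.^ N) →
               Σ ℕ λ d → Σ (Fin d → Vector N) (Basis P)
      extend zero {d} G _ independent d+0≡ =
        ⊥-elim (ℕ.<⇒≱ (ℕ.<-≤-trans (n<m^n d 2≤s) (independent-size independent))
                      (ℕ.≤-trans (ℕ.n≤1+n _) (ℕ.≤-reflexive (≡.trans (≡.sym d+0≡) (ℕ.+-identityʳ d)))))
      extend (suc fuel) {d} G G∈P independent d+fuel≡
        with search (λ v → P v × ¬ InSpan G v)
                    (λ u≈v (Pu , u∉) → P-resp u≈v Pu , u∉ ∘ InSpan-resp G (≈ᵛ-sym u≈v))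
                    (λ v → P? v ×-dec ¬? (InSpan? G v))
      ... | yes (v , Pv , v∉) = extend fuel (v ∷ᵛ G) (λ { zero → Pv ; (suc t) → G∈P t })
                                  (independent-∷ independent v∉) (≡.trans (≡.sym (ℕ.+-suc d fuel)) d+fuel≡)
      ... | no  none = d , G , record
        { ∈P = G∈P ; independent = independent
        ; spans = λ v Pv → decidable-stable (InSpan? G v) (λ v∉ → none (v , Pv , v∉)) }

    module LinearMap {M N} (h : Vector M → Vector N) (h-cong : ∀ {u v} → u ≈ᵛ v → h u ≈ᵛ h v)
                     (h-linear : ∀ {d} (a : Vector d) (y : Fin d → Vector M) → Scalars a →
                                 h (combination a y) ≈ᵛ combination a (h ∘ y)) where

      Image : Vector N → Set (c ⊔ ℓ)
      Image w = Σ (Vector M) λ x → w ≈ᵛ h x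

      Image? : ∀ w → Dec (Image w)
      Image? w = search (λ x → w ≈ᵛ h x) (λ x≈y w≈hx → ≈ᵛ-trans w≈hx (h-cong x≈y)) (λ x → w ≟ᵛ h x)

      Image-resp : ∀ {u v} → u ≈ᵛ v → Image u → Image v
      Image-resp u≈v (x , u≈hx) = x , ≈ᵛ-trans (≈ᵛ-sym u≈v) u≈hx

      imageBasis : Σ ℕ λ d → Σ (Fin d → Vector N) (Basis Image)
      imageBasis = basis Image Image-resp Image?

      h-difference : ∀ u v → h (λ i → u i - v i) ≈ᵛ (λ t → h u t - h v t)
      h-difference u v t = begin
        h (λ i → u i - v i) t                        ≈⟨ h-cong (λ i → sym (1·u-1·v u v i)) t ⟩
        h (combination ±1 (u ∷ᵛ v ∷ᵛ []ᵛ)) t        ≈⟨ h-linear ±1 (u ∷ᵛ v ∷ᵛ []ᵛ) ±1∈K t ⟩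
        combination ±1 (h u ∷ᵛ h v ∷ᵛ []ᵛ) t        ≈⟨ 1·u-1·v (h u) (h v) t ⟩
        h u t - h v t                                ∎
        where
        ±1 : Vector 2
        ±1 = 1# ∷ᵛ - 1# ∷ᵛ []ᵛ
        ±1∈K : Scalars ±1
        ±1∈K zero       = K-1
        ±1∈K (suc zero) = K-- K-1
        1·u-1·v : ∀ {L} (u v : Vector L) i → combination ±1 (u ∷ᵛ v ∷ᵛ []ᵛ) i ≈ u i - v i
        1·u-1·v u v i = +-cong (*-identityˡ (u i)) (trans (+-identityʳ _) (-1*x≈-x (v i)))

      kernel-trivial⇒injective : (∀ x → h x ≈ᵛ (λ _ → 0#) → x ≈ᵛ (λ _ → 0#)) → ∀ u v → h u ≈ᵛ h v → u ≈ᵛ v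
      kernel-trivial⇒injective trivial u v hu≈hv i = x∙y⁻¹≈ε⇒x≈y (u i) (v i)
        (trivial (λ i → u i - v i) (λ t → trans (h-difference u v t) (x≈y⇒x∙y⁻¹≈ε (hu≈hv t))) i)

      module _ {d} {V : Fin d → Vector N} (V-basis : Basis Image V) where

        open Basis V-basis

        preimage : Fin d → Vector M
        preimage t = proj₁ (∈P t)

        -- K-combinations of preimages of V are separated by h, so there are s ^ d of them
        lift : Vector d → Vector M
        lift a = combination a preimage

        h∘lift : ∀ a → Scalars a → h (lift a) ≈ᵛ combination a V
        h∘lift a a∈ = ≈ᵛ-trans (h-linear a preimage a∈) (combination-congʳ a (λ t → ≈ᵛ-sym (proj₂ (∈P t))))

        lift-injective : ∀ a b → Scalars a → Scalars b → lift a ≈ᵛ lift b → a ≈ᵛ b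
        lift-injective a b a∈ b∈ eq = independent⇒injective independent a∈ b∈
          (≈ᵛ-trans (≈ᵛ-sym (h∘lift a a∈)) (≈ᵛ-trans (h-cong eq) (h∘lift b b∈)))

        -- a full-size image basis makes lift onto, hence every x with h x ≈ 0 is lift 0
        full-image⇒kernel-trivial : s ℕ.^ d ≡ Q ℕ.^ M → ∀ x → h x ≈ᵛ (λ _ → 0#) → x ≈ᵛ (λ _ → 0#)
        full-image⇒kernel-trivial s^d≡Q^M x hx≈0
          with (a , a∈ , lift-a≈x) ← injection-onto (scalarVectors d) (allVectors M) lift (λ _ _ _ → tt) lift-injective
                                                    s^d≡Q^M x (λ _ → tt) = λ i → begin
          x i                      ≈⟨ lift-a≈x i ⟨
          lift a i                 ≈⟨ sum-zero (λ t → trans (*-congʳ (a≈0 t)) (zeroˡ _)) ⟩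
          0#                       ∎
          where
          a≈0 : ∀ t → a t ≈ 0#
          a≈0 = independent a a∈ (≈ᵛ-trans (≈ᵛ-sym (h∘lift a a∈)) (≈ᵛ-trans (h-cong lift-a≈x) hx≈0))

        -- coordinates with respect to V separate the points of F^M when h is injective
        kernel-trivial⇒full-image : (∀ x → h x ≈ᵛ (λ _ → 0#) → x ≈ᵛ (λ _ → 0#)) → s ℕ.^ d ≡ Q ℕ.^ M
        kernel-trivial⇒full-image trivial = ℕ.≤-antisym
          (injection-size (scalarVectors d) (allVectors M) lift (λ _ _ _ → tt) lift-injective)
          (injection-size (allVectors M) (scalarVectors d) coordinates (λ y _ → proj₁ (proj₂ (expand y))) coordinates-injective)
          where
          expand : ∀ y → InSpan V (h y)
          expand y = spans (h y) (y , λ _ → refl)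
          coordinates : Vector M → Vector d
          coordinates y = proj₁ (expand y)
          coordinates-injective : ∀ y y′ → (∀ i → ⊤) → (∀ i → ⊤) → coordinates y ≈ᵛ coordinates y′ → y ≈ᵛ y′
          coordinates-injective y y′ _ _ eq = kernel-trivial⇒injective trivial y y′
            (≈ᵛ-trans (proj₂ (proj₂ (expand y))) (≈ᵛ-trans (combination-congˡ V eq) (≈ᵛ-sym (proj₂ (proj₂ (expand y′))))))

module Linearized {c ℓ} (F : Field c ℓ) {q n} (q-primePower : IsPrimePower q) (1≤n : 1 ≤ n)
                  (card : HasCardinality F (q ℕ.^ n)) (m : ℕ) where

  open Field F hiding (zero)
  open FieldProperties F
  open FiniteField F card using (x^Q≈x)
  open Subfield F q-primePower 1≤n card
    using (InFq; InFq-resp; InFq-0; InFq-+; InFq-^q^j; ^q-additive; ^q^j-additive; 0^q≈0; elements; elements-unique; 2≤q; q≢0)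
  open LinearizedPolynomials F q n m
  open Polynomials F using (sparse-root-bound)
  open ≈-Reasoning
  import Data.List.Relation.Unary.All.Properties as All
  open import Data.List.Properties using (length-tabulate)

  pow≡^ : ∀ x e → pow x e ≡ x ^ e
  pow≡^ x zero    = ≡.refl
  pow≡^ x (suc e) = ≡.cong (x *_) (pow≡^ x e)

  sumFin≈sum : ∀ {k} {f g : Fin k → Carrier} → (∀ i → f i ≈ g i) → sumFin f ≈ sum g
  sumFin≈sum {zero}  f≈g = refl
  sumFin≈sum {suc k} f≈g = +-cong (f≈g zero) (sumFin≈sum (f≈g ∘ suc))

  sumFin≡sum : ∀ {k} (f : Fin k → Carrier) → sumFin f ≡ sum f
  sumFin≡sum {zero}  f = ≡.refl
  sumFin≡sum {suc k} f = ≡.cong (f zero +_) (sumFin≡sum (f ∘ suc))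

  IsFq⇒InFq : ∀ {x} → IsFq x → InFq x
  IsFq⇒InFq {x} = ≡.subst (_≈ x) (pow≡^ x q)

  InFq⇒IsFq : ∀ {x} → InFq x → IsFq x
  InFq⇒IsFq {x} = ≡.subst (_≈ x) (≡.sym (pow≡^ x q))

  infixr 8 _^q^_
  _^q^_ : ∀ {N} → Carrier → Fin N → Carrier
  z ^q^ j = z ^ (q ℕ.^ toℕ j)

  evaluate₁ : ∀ {N} → (Fin N → Carrier) → Carrier → Carrier
  evaluate₁ a z = sum (λ j → a j * z ^q^ j)

  eval≈ : ∀ f x → eval f x ≈ sum (λ i → evaluate₁ (f i) (x i))
  eval≈ f x = sumFin≈sum {g = λ i → evaluate₁ (f i) (x i)}
                (λ i → sumFin≈sum {g = λ j → f i j * x i ^q^ j} (λ j → *-congˡ (reflexive (pow≡^ (x i) (q ℕ.^ toℕ j)))))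

  ⋆≈ : ∀ f g → f ⋆ g ≈ sum (λ i → sum (λ j → f i j * g i j))
  ⋆≈ f g = sumFin≈sum {g = λ i → sum (λ j → f i j * g i j)} (λ i → sumFin≈sum {g = λ j → f i j * g i j} (λ j → refl))

  ^q^-additive : ∀ {N} (j : Fin N) x y → (x + y) ^q^ j ≈ x ^q^ j + y ^q^ j
  ^q^-additive j = ^q^j-additive (toℕ j)

  ^q^-homogeneous : ∀ {N} (j : Fin N) {c} x → InFq c → (c * x) ^q^ j ≈ c * x ^q^ j
  ^q^-homogeneous j {c} x c∈ = trans (^-distrib-* c x (q ℕ.^ toℕ j)) (*-congʳ (InFq-^q^j c∈ (toℕ j)))

  0^q^j≈0 : ∀ {N} (j : Fin N) → 0# ^q^ j ≈ 0#
  0^q^j≈0 j = trans (^-congʳ 0# (≡.sym (ℕ.suc-pred (q ℕ.^ toℕ j) {{ℕ.m^n≢0 q (toℕ j)}}))) (zeroˡ _)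

  evaluate₁-additive : ∀ {N} (a : Fin N → Carrier) x y → evaluate₁ a (x + y) ≈ evaluate₁ a x + evaluate₁ a y
  evaluate₁-additive {N} a x y = trans (sum-cong-≋ {N} (λ j → trans (*-congˡ (^q^-additive j x y)) (distribˡ _ _ _)))
                                   (∑-distrib-+ (λ j → a j * x ^q^ j) (λ j → a j * y ^q^ j))

  evaluate₁-homogeneous : ∀ {N} (a : Fin N → Carrier) {c} x → InFq c → evaluate₁ a (c * x) ≈ c * evaluate₁ a x
  evaluate₁-homogeneous {N} a {c} x c∈ = trans (sum-cong-≋ {N} (λ j → trans (*-congˡ (^q^-homogeneous j x c∈))
    (x*[y*z]≈y*[x*z] (a j) c (x ^q^ j)))) (sym (*-distribˡ-sum c (λ j → a j * x ^q^ j)))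

  evaluate₁-zero : ∀ {N} (a : Fin N → Carrier) → evaluate₁ a 0# ≈ 0#
  evaluate₁-zero {N} a = sum-zero {N} (λ j → trans (*-congˡ (0^q^j≈0 j)) (zeroʳ _))

  evaluate₁-cong : ∀ {N} (a : Fin N → Carrier) {x y} → x ≈ y → evaluate₁ a x ≈ evaluate₁ a y
  evaluate₁-cong {N} a x≈y = sum-cong-≋ {N} (λ j → *-congˡ {a j} (^-congˡ (q ℕ.^ toℕ j) x≈y))

  -- Z, Z^q, …, Z^(q^(n-1)) are linearly independent functions: their degrees are below the Q roots
  evaluate₁-vanishing : ∀ (a : Fin n → Carrier) → (∀ z → evaluate₁ a z ≈ 0#) → ∀ j → a j ≈ 0#
  evaluate₁-vanishing a a≈0 = sparse-root-bound (λ j → q ℕ.^ toℕ j) a exponent-injective exponent≤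
    elements elements-unique (All.tabulate⁺ (λ i → a≈0 _)) (≡.subst (suc (q ℕ.^ ℕ.pred n) ≤_) (≡.sym (length-tabulate _)) degree<Q)
    where
    exponent-injective : ∀ s t → q ℕ.^ toℕ s ≡ q ℕ.^ toℕ t → s ≡ t
    exponent-injective s t eq = Fin.toℕ-injective (^-injectiveʳ 2≤q eq)
    exponent≤ : ∀ t → q ℕ.^ toℕ t ≤ q ℕ.^ ℕ.pred n
    exponent≤ t = ℕ.^-monoʳ-≤ q (ℕ.≤-pred (≡.subst (toℕ t <_) (≡.sym (ℕ.suc-pred n {{ℕ.>-nonZero 1≤n}})) (Fin.toℕ<n t)))
    degree<Q : q ℕ.^ ℕ.pred n < q ℕ.^ n
    degree<Q = ≡.subst (q ℕ.^ ℕ.pred n <_) (≡.cong (q ℕ.^_) (ℕ.suc-pred n {{ℕ.>-nonZero 1≤n}}))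
                 (ℕ.^-monoʳ-< q 2≤q (ℕ.n<1+n (ℕ.pred n)))

  evaluate₁-lincomb : ∀ {k} (a : Fin k → Carrier) (b : Fin k → Fin n → Carrier) z →
                      evaluate₁ (λ j → sum (λ t → a t * b t j)) z ≈ sum (λ t → a t * evaluate₁ (b t) z)
  evaluate₁-lincomb {k} a b z = begin
    sum (λ j → sum (λ t → a t * b t j) * z ^q^ j)       ≈⟨ sum-cong-≋ (λ j → *-distribʳ-sum (z ^q^ j) (λ t → a t * b t j)) ⟩
    sum (λ j → sum (λ t → (a t * b t j) * z ^q^ j))     ≈⟨ sum-cong-≋ (λ j → sum-cong-≋ {k} (λ t → *-assoc (a t) (b t j) _)) ⟩
    sum (λ j → sum (λ t → a t * (b t j * z ^q^ j)))     ≈⟨ sum-linear a (λ t j → b t j * z ^q^ j) ⟩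
    sum (λ t → a t * evaluate₁ (b t) z)                 ∎

  evaluate₁-combination : ∀ {N k} (b : Fin N → Carrier) (a : Fin k → Carrier) (y : Fin k → Carrier) → (∀ t → InFq (a t)) →
                          evaluate₁ b (sum (λ t → a t * y t)) ≈ sum (λ t → a t * evaluate₁ b (y t))
  evaluate₁-combination {k = zero}  b a y _   = evaluate₁-zero b
  evaluate₁-combination {k = suc k} b a y a∈ = begin
    evaluate₁ b (a zero * y zero + sum (λ t → a (suc t) * y (suc t)))
      ≈⟨ evaluate₁-additive b _ _ ⟩
    evaluate₁ b (a zero * y zero) + evaluate₁ b (sum (λ t → a (suc t) * y (suc t)))
      ≈⟨ +-cong (evaluate₁-homogeneous b (y zero) (a∈ zero)) (evaluate₁-combination b (a ∘ suc) (y ∘ suc) (a∈ ∘ suc)) ⟩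
    a zero * evaluate₁ b (y zero) + sum (λ t → a (suc t) * evaluate₁ b (y (suc t))) ∎

  eval-congˡ : ∀ {f g} x → f ≈P g → eval f x ≈ eval g x
  eval-congˡ {f} {g} x f≈g = begin
    eval f x                             ≈⟨ eval≈ f x ⟩
    sum (λ i → evaluate₁ (f i) (x i))    ≈⟨ sum-cong-≋ (λ i → sum-cong-≋ {n} (λ j → *-congʳ (f≈g i j))) ⟩
    sum (λ i → evaluate₁ (g i) (x i))    ≈⟨ eval≈ g x ⟨
    eval g x                             ∎

  eval-congʳ : ∀ f {x y} → (∀ i → x i ≈ y i) → eval f x ≈ eval f y
  eval-congʳ f {x} {y} x≈y = begin
    eval f x                             ≈⟨ eval≈ f x ⟩
    sum (λ i → evaluate₁ (f i) (x i))    ≈⟨ sum-cong-≋ (λ i → evaluate₁-cong (f i) (x≈y i)) ⟩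
    sum (λ i → evaluate₁ (f i) (y i))    ≈⟨ eval≈ f y ⟨
    eval f y                             ∎

  eval-lincomb : ∀ {k} (a : Fin k → Carrier) (G : Fin k → LinPoly) x →
                 eval (lincomb a G) x ≈ sum (λ t → a t * eval (G t) x)
  eval-lincomb {k} a G x = begin
    eval (lincomb a G) x                                               ≈⟨ eval≈ (lincomb a G) x ⟩
    sum (λ i → evaluate₁ (lincomb a G i) (x i))                        ≈⟨ sum-cong-≋ (λ i → evaluate₁-cong′ i) ⟩
    sum (λ i → evaluate₁ (λ j → sum (λ t → a t * G t i j)) (x i))
                                                                       ≈⟨ sum-cong-≋ (λ i → evaluate₁-lincomb a (λ t → G t i) (x i)) ⟩
    sum (λ i → sum (λ t → a t * evaluate₁ (G t i) (x i)))              ≈⟨ sum-linear a (λ t i → evaluate₁ (G t i) (x i)) ⟩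
    sum (λ t → a t * sum (λ i → evaluate₁ (G t i) (x i)))              ≈⟨ sum-cong-≋ (λ t → *-congˡ (eval≈ (G t) x)) ⟨
    sum (λ t → a t * eval (G t) x)                                     ∎
    where
    evaluate₁-cong′ : ∀ i → evaluate₁ (lincomb a G i) (x i) ≈ evaluate₁ (λ j → sum (λ t → a t * G t i j)) (x i)
    evaluate₁-cong′ i = sum-cong-≋ {n} (λ j → *-congʳ (reflexive (sumFin≡sum (λ t → a t * G t i j))))

  eval-·P : ∀ a f x → eval (a ·P f) x ≈ a * eval f x
  eval-·P a f x = begin
    eval (a ·P f) x                                     ≈⟨ eval≈ (a ·P f) x ⟩
    sum (λ i → sum (λ j → (a * f i j) * x i ^q^ j))     ≈⟨ sum-cong-≋ (λ i → sum-cong-≋ {n} (λ j → *-assoc a (f i j) _)) ⟩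
    sum (λ i → sum (λ j → a * (f i j * x i ^q^ j)))     ≈⟨ sum-cong-≋ (λ i → *-distribˡ-sum a (λ j → f i j * x i ^q^ j)) ⟨
    sum (λ i → a * evaluate₁ (f i) (x i))               ≈⟨ *-distribˡ-sum a (λ i → evaluate₁ (f i) (x i)) ⟨
    a * sum (λ i → evaluate₁ (f i) (x i))               ≈⟨ *-congˡ (eval≈ f x) ⟨
    a * eval f x                                        ∎

  eval-combination : ∀ {k} f (a : Fin k → Carrier) (y : Fin k → Vect m) → (∀ t → InFq (a t)) →
                     eval f (λ i → sum (λ t → a t * y t i)) ≈ sum (λ t → a t * eval f (y t))
  eval-combination {k} f a y a∈ = begin
    eval f (λ i → sum (λ t → a t * y t i))                     ≈⟨ eval≈ f _ ⟩
    sum (λ i → evaluate₁ (f i) (sum (λ t → a t * y t i)))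
                                                               ≈⟨ sum-cong-≋ (λ i → evaluate₁-combination (f i) a (λ t → y t i) a∈) ⟩
    sum (λ i → sum (λ t → a t * evaluate₁ (f i) (y t i)))      ≈⟨ sum-linear a (λ t i → evaluate₁ (f i) (y t i)) ⟩
    sum (λ t → a t * sum (λ i → evaluate₁ (f i) (y t i)))      ≈⟨ sum-cong-≋ (λ t → *-congˡ (eval≈ f (y t))) ⟨
    sum (λ t → a t * eval f (y t))                             ∎

  δ : Fin m → Carrier → Vect m
  δ i z k with k Fin.≟ i
  ... | yes _ = z
  ... | no  _ = 0#

  eval-δ : ∀ f i z → eval f (δ i z) ≈ evaluate₁ (f i) z
  eval-δ f i z = trans (eval≈ f (δ i z)) (trans (sum-δ i δ-elsewhere) (evaluate₁-cong (f i) δ-here))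
    where
    δ-here : δ i z i ≈ z
    δ-here with i Fin.≟ i
    ... | yes _   = refl
    ... | no  i≢i = ⊥-elim (i≢i ≡.refl)
    δ-elsewhere : ∀ k → ¬ k ≡ i → evaluate₁ (f k) (δ i z k) ≈ 0#
    δ-elsewhere k k≢i with k Fin.≟ i
    ... | yes k≡i = ⊥-elim (k≢i k≡i)
    ... | no  _   = evaluate₁-zero (f k)

  eval-vanishing : ∀ f → (∀ x → eval f x ≈ 0#) → f ≈P 0P
  eval-vanishing f f≈0 i = evaluate₁-vanishing (f i) (λ z → trans (sym (eval-δ f i z)) (f≈0 (δ i z)))

  ^q-sum : ∀ {k} (g : Fin k → Carrier) → sum g ^ q ≈ sum (λ t → g t ^ q)
  ^q-sum {zero}  g = 0^q≈0
  ^q-sum {suc k} g = trans (^q-additive _ _) (+-congˡ (^q-sum (g ∘ suc)))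

  -- the coefficients of Σⱼ aⱼ Z^(q^j) raised to the q-th power, as a polynomial modulo Z^(q^N) - Z
  cycle : ∀ {N} → (Fin N → Carrier) → Fin N → Carrier
  cycle {suc N} a zero    = a (Fin.fromℕ N) ^ q
  cycle {suc N} a (suc j) = a (Fin.inject₁ j) ^ q

  evaluate₁-^q : ∀ {N} (a : Fin N → Carrier) z → z ^ (q ℕ.^ N) ≈ z → evaluate₁ a z ^ q ≈ evaluate₁ (cycle a) z
  evaluate₁-^q {zero}  a z _        = 0^q≈0
  evaluate₁-^q {suc N} a z z^q^N≈z = begin
    evaluate₁ a z ^ q                                         ≈⟨ ^q-sum (λ j → a j * z ^q^ j) ⟩
    sum (λ j → (a j * z ^q^ j) ^ q)                           ≈⟨ sum-cong-≋ (λ j → term^q (a j) (toℕ j)) ⟩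
    sum g                                                     ≈⟨ sum-init-last g ⟩
    sum (λ j → g (Fin.inject₁ j)) + g (Fin.fromℕ N)          ≈⟨ +-comm _ _ ⟩
    g (Fin.fromℕ N) + sum (λ j → g (Fin.inject₁ j))          ≈⟨ +-cong last≈ (sum-cong-≋ init≈) ⟩
    evaluate₁ (cycle a) z                                     ∎
    where
    g : Fin (suc N) → Carrier
    g j = a j ^ q * z ^ (q ℕ.^ suc (toℕ j))
    term^q : ∀ b k → (b * z ^ (q ℕ.^ k)) ^ q ≈ b ^ q * z ^ (q ℕ.^ suc k)
    term^q b k = trans (^-distrib-* b _ q) (*-congˡ (trans (^-assocʳ z (q ℕ.^ k) q)
                   (^-congʳ z (ℕ.*-comm (q ℕ.^ k) q))))
    init≈ : ∀ j → g (Fin.inject₁ j) ≈ cycle a (suc j) * z ^q^ (suc j)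
    init≈ j = *-congˡ (^-congʳ z (≡.cong (λ k → q ℕ.^ suc k) (Fin.toℕ-inject₁ j)))
    last≈ : g (Fin.fromℕ N) ≈ cycle a zero * z ^q^ (zero {N})
    last≈ = *-congˡ (trans (^-congʳ z (≡.cong (λ k → q ℕ.^ suc k) (Fin.toℕ-fromℕ N)))
                           (trans z^q^N≈z (sym (*-identityʳ z))))

  trace-InFq : ∀ z → InFq (evaluate₁ {n} (λ _ → 1#) z)
  trace-InFq z = trans (evaluate₁-^q {n} (λ _ → 1#) z (x^Q≈x z)) (sum-cong-≋ {n} (λ j → *-congʳ {z ^q^ j} (cycle-1 j)))
    where
    cycle-1 : ∀ {N} (j : Fin N) → cycle (λ _ → 1#) j ≈ 1#
    cycle-1 zero    = 1^n≈1 q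
    cycle-1 (suc j) = 1^n≈1 q

  cycle-fixed⇒orbit : ∀ {N} (a : Fin N → Carrier) → (∀ j → cycle a j ≈ a j) →
                      ∀ j₀ → toℕ j₀ ≡ 0 → ∀ j → a j ≈ a j₀ ^q^ j
  cycle-fixed⇒orbit {suc N} a fixed zero _ j = orbit (toℕ j) j ≡.refl
    where
    orbit : ∀ k (j : Fin (suc N)) → toℕ j ≡ k → a j ≈ a zero ^ (q ℕ.^ k)
    orbit zero    zero    _  = sym (*-identityʳ _)
    orbit (suc k) (suc j) eq = begin
      a (suc j)                             ≈⟨ fixed (suc j) ⟨
      a (Fin.inject₁ j) ^ q
        ≈⟨ ^-congˡ q (orbit k (Fin.inject₁ j) (≡.trans (Fin.toℕ-inject₁ j) (ℕ.suc-injective eq))) ⟩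
      (a zero ^ (q ℕ.^ k)) ^ q              ≈⟨ ^-assocʳ (a zero) (q ℕ.^ k) q ⟩
      a zero ^ (q ℕ.^ k ℕ.* q)              ≡⟨ ≡.cong (a zero ^_) (ℕ.*-comm (q ℕ.^ k) q) ⟩
      a zero ^ (q ℕ.^ suc k)                ∎

  InFq-valued⇒orbit : ∀ (a : Fin n → Carrier) → (∀ z → InFq (evaluate₁ a z)) →
                      ∀ j₀ → toℕ j₀ ≡ 0 → ∀ j → a j ≈ a j₀ ^q^ j
  InFq-valued⇒orbit a a∈ =
    cycle-fixed⇒orbit a (λ j → x∙y⁻¹≈ε⇒x≈y _ _ (evaluate₁-vanishing (λ j → cycle a j - a j) difference j))
    where
    difference : ∀ z → evaluate₁ (λ j → cycle a j - a j) z ≈ 0#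
    difference z = begin
      sum (λ j → (cycle a j - a j) * z ^q^ j)
        ≈⟨ sum-cong-≋ (λ j → [y-z]x≈yx-zx (z ^q^ j) (cycle a j) (a j)) ⟩
      sum (λ j → cycle a j * z ^q^ j - a j * z ^q^ j)
        ≈⟨ ∑-distrib-+ (λ j → cycle a j * z ^q^ j) _ ⟩
      evaluate₁ (cycle a) z + sum (λ j → - (a j * z ^q^ j))
        ≈⟨ +-congˡ (sum-neg (λ j → a j * z ^q^ j)) ⟩
      evaluate₁ (cycle a) z - evaluate₁ a z
        ≈⟨ x≈y⇒x∙y⁻¹≈ε (trans (sym (evaluate₁-^q a z (x^Q≈x z))) (a∈ z)) ⟩
      0#
        ∎

module Criteria {c ℓ p} (F : Field c ℓ) {q n m} (q-primePower : IsPrimePower q) (1≤n : 1 ≤ n)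
                (card : HasCardinality F (q ℕ.^ n)) (C : LinearizedPolynomials.LinPoly F q n m → Set p)
                (code : LinearizedPolynomials.IsCode F q n m C) where

  open Field F hiding (zero)
  open FieldProperties F
  open FiniteField F card using (_≟_)
  open Subfield F q-primePower 1≤n card using (InFq; InFq-resp; InFq-*; InFq-⁻¹; InFq-sum; InFq-isSubfield; Fq-enumeration; |Fq|; |Fq|≡q)
  open Linearized F q-primePower 1≤n card m
  open LinearizedPolynomials F q n m
  open LinearAlgebra F card
  open IsCode code
  open ≈-Reasoning
  module Fq-Span = Span InFq-isSubfield Fq-enumeration
  module F-Span = Span whole-isSubfield allScalars

  basis-kernel : ∀ {k G} → IsBasis C k G → ∀ x → (∀ t → eval (G t) x ≈ 0#) → ∀ f → C f → eval f x ≈ 0#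
  basis-kernel {G = G} G-basis x Gx≈0 f f∈C with (a , f≈a·G) ← IsBasis.span G-basis f f∈C = begin
    eval f x                          ≈⟨ eval-congˡ x f≈a·G ⟩
    eval (lincomb a G) x              ≈⟨ eval-lincomb a G x ⟩
    sum (λ t → a t * eval (G t) x)    ≈⟨ sum-zero (λ t → trans (*-congˡ (Gx≈0 t)) (zeroʳ _)) ⟩
    0#                                ∎

  toVector : LinPoly → Vector (m ℕ.* n)
  toVector f k = f (proj₁ (Fin.remQuot {m} n k)) (proj₂ (Fin.remQuot {m} n k))

  fromVector : Vector (m ℕ.* n) → LinPoly
  fromVector v i j = v (Fin.combine i j)

  fromVector-toVector : ∀ f → fromVector (toVector f) ≈P f
  fromVector-toVector f i j = reflexive (≡.cong (λ ij → f (proj₁ ij) (proj₂ ij)) (Fin.remQuot-combine {m} {n} i j))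

  basis-of-decidable : (∀ f → Dec (C f)) → Σ ℕ λ k → Σ (Fin k → LinPoly) (IsBasis C k)
  basis-of-decidable C?
    with (d , V , V-basis) ← F-Span.basis {N = m ℕ.* n} (C ∘ fromVector) (λ u≈v → resp (λ i j → u≈v (Fin.combine i j)))
                                                      (C? ∘ fromVector) =
    d , fromVector ∘ V , record { in-C = ∈P ; indep = indep ; span = spanning }
    where
    open F-Span
    open Basis V-basis
    lincomb≈ : ∀ a i j → lincomb a (fromVector ∘ V) i j ≈ combination a V (Fin.combine i j)
    lincomb≈ a i j = reflexive (sumFin≡sum (λ t → a t * V t (Fin.combine i j)))
    indep : ∀ a → lincomb a (fromVector ∘ V) ≈P 0P → ∀ t → a t ≈ 0#
    indep a a·V≈0 = independent a (λ _ → tt) λ k →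
      ≡.subst (λ k → combination a V k ≈ 0#) (Fin.combine-remQuot {m} n k) (trans (sym (lincomb≈ a _ _)) (a·V≈0 _ _))
    spanning : ∀ f → C f → Σ (Vector d) λ a → f ≈P lincomb a (fromVector ∘ V)
    spanning f f∈C with (a , _ , f≈) ← spans (toVector f) (resp (λ i j → sym (fromVector-toVector f i j)) f∈C) =
      a , λ i j → trans (sym (fromVector-toVector f i j)) (trans (f≈ (Fin.combine i j)) (sym (lincomb≈ a i j)))

  -- C has a basis, but only up to double negation: membership in C need not be decidable
  ¬¬-basis : ¬ ¬ (Σ ℕ λ k → Σ (Fin k → LinPoly) (IsBasis C k))
  ¬¬-basis no-basis = ¬¬-decidable-Fin ((q ℕ.^ n) ℕ.^ (m ℕ.* n)) (C ∘ fromVector ∘ element) λ C? →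
    no-basis (basis-of-decidable (λ f → decide f (C? (index f))))
    where
    open Enumeration (allVectors (m ℕ.* n))
    index : LinPoly → Fin ((q ℕ.^ n) ℕ.^ (m ℕ.* n))
    index f = proj₁ (element-surjective (toVector f) (λ _ → tt))
    element≈ : ∀ f → fromVector (element (index f)) ≈P f
    element≈ f i j = trans (proj₂ (element-surjective (toVector f) (λ _ → tt)) (Fin.combine i j)) (fromVector-toVector f i j)
    decide : ∀ f → Dec (C (fromVector (element (index f)))) → Dec (C f)
    decide f (yes c) = yes (resp (element≈ f) c)
    decide f (no ¬c) = no (¬c ∘ resp (λ i j → sym (element≈ f i j)))

  IsZeroVec? : ∀ x → Dec (IsZeroVec x)
  IsZeroVec? x = Fin.all? (λ i → x i ≟ 0#)

  kernelsTrivial⇒basisKernelsTrivial : KernelsTrivial C → BasisKernelsTrivial C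
  kernelsTrivial⇒basisKernelsTrivial trivial k G G-basis x Gx≈0 = trivial x (basis-kernel G-basis x Gx≈0)

  basisKernelsTrivial⇒kernelsTrivial : BasisKernelsTrivial C → KernelsTrivial C
  basisKernelsTrivial⇒kernelsTrivial trivial x x∈ker = decidable-stable (IsZeroVec? x) λ x≉0 →
    ¬¬-basis λ (k , G , G-basis) → x≉0 (trivial k G G-basis x (λ t → x∈ker (G t) (IsBasis.in-C G-basis t)))

  HasFqDim⇒Basis : ∀ {k d p′} {U : Vect k → Set p′} (H : HasFqDim U d) → Fq-Span.Basis U (HasFqDim.vec H)
  HasFqDim⇒Basis H = record
    { ∈P          = in-U
    ; independent = λ a a∈ a·vec≈0 → indep a (InFq⇒IsFq ∘ a∈)
                      (λ s → trans (reflexive (sumFin≡sum (λ t → a t * vec t s))) (a·vec≈0 s))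
    ; spans       = λ w w∈ → let (a , a∈ , w≈) = span w w∈ in
                      a , IsFq⇒InFq ∘ a∈ , λ s → trans (w≈ s) (reflexive (sumFin≡sum (λ t → a t * vec t s)))
    }
    where open HasFqDim H

  Basis⇒HasFqDim : ∀ {k d p′} {U : Vect k → Set p′} {V : Fin d → Vect k} → Fq-Span.Basis U V → HasFqDim U d
  Basis⇒HasFqDim {V = V} V-basis = record
    { vec   = V
    ; in-U  = ∈P
    ; indep = λ a a∈ a·V≈0 → independent a (IsFq⇒InFq ∘ a∈)
                (λ s → trans (reflexive (≡.sym (sumFin≡sum (λ t → a t * V t s)))) (a·V≈0 s))
    ; span  = λ w w∈ → let (a , a∈ , w≈) = spans w w∈ in
                a , InFq⇒IsFq ∘ a∈ , λ s → trans (w≈ s) (reflexive (≡.sym (sumFin≡sum (λ t → a t * V t s))))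
    }
    where open Fq-Span.Basis V-basis

  module Evaluation {k} (G : Fin k → LinPoly) =
    Fq-Span.LinearMap (λ x t → eval (G t) x) (λ x≈y t → eval-congʳ (G t) x≈y) (λ a y a∈ t → eval-combination (G t) a y a∈)

  |Fq|^[n*m]≡Q^m : |Fq| ℕ.^ (n ℕ.* m) ≡ (q ℕ.^ n) ℕ.^ m
  |Fq|^[n*m]≡Q^m = ≡.trans (≡.cong (ℕ._^ (n ℕ.* m)) |Fq|≡q) (≡.sym (ℕ.^-*-assoc q n m))

  nondegenerate⇒kernelsTrivial : Nondegenerate C → KernelsTrivial C
  nondegenerate⇒kernelsTrivial nondegenerate x x∈ker = decidable-stable (IsZeroVec? x) λ x≉0 →
    ¬¬-basis λ (k , G , G-basis) → x≉0 (Evaluation.full-image⇒kernel-trivial G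
      (HasFqDim⇒Basis (nondegenerate k G G-basis)) |Fq|^[n*m]≡Q^m x (λ t → x∈ker (G t) (IsBasis.in-C G-basis t)))

  kernelsTrivial⇒nondegenerate : KernelsTrivial C → Nondegenerate C
  kernelsTrivial⇒nondegenerate trivial k G G-basis with (d , V , V-basis) ← Evaluation.imageBasis G =
    ≡.subst (HasFqDim U[ G ]) d≡n*m (Basis⇒HasFqDim V-basis)
    where
    d≡n*m : d ≡ n ℕ.* m
    d≡n*m = ^-injectiveʳ Fq-Span.2≤s (≡.trans (Evaluation.kernel-trivial⇒full-image G V-basis
      (λ x Gx≈0 → trivial x (basis-kernel G-basis x Gx≈0))) (≡.sym |Fq|^[n*m]≡Q^m))

  first : Fin n
  first = Fin.fromℕ< 1≤n

  x^q^first≈x : ∀ x → x ^q^ first ≈ x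
  x^q^first≈x x = trans (^-congʳ x (≡.cong (q ℕ.^_) (Fin.toℕ-fromℕ< 1≤n))) (*-identityʳ x)

  frobeniusPoly : Vect m → LinPoly
  frobeniusPoly x i j = x i ^q^ j

  ⋆-congˡ : ∀ {f f′} g → f ≈P f′ → f ⋆ g ≈ f′ ⋆ g
  ⋆-congˡ {f} {f′} g f≈f′ =
    trans (⋆≈ f g) (trans (sum-cong-≋ (λ i → sum-cong-≋ {n} (λ j → *-congʳ (f≈f′ i j)))) (sym (⋆≈ f′ g)))

  ⋆-·P : ∀ a f g → (a ·P f) ⋆ g ≈ a * (f ⋆ g)
  ⋆-·P a f g = begin
    (a ·P f) ⋆ g                                   ≈⟨ ⋆≈ (a ·P f) g ⟩
    sum (λ i → sum (λ j → (a * f i j) * g i j))    ≈⟨ sum-cong-≋ (λ i → sum-cong-≋ {n} (λ j → *-assoc a (f i j) (g i j))) ⟩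
    sum (λ i → sum (λ j → a * (f i j * g i j)))    ≈⟨ sum-cong-≋ (λ i → *-distribˡ-sum a (λ j → f i j * g i j)) ⟨
    sum (λ i → a * sum (λ j → f i j * g i j))      ≈⟨ *-distribˡ-sum a (λ i → sum (λ j → f i j * g i j)) ⟨
    a * sum (λ i → sum (λ j → f i j * g i j))      ≈⟨ *-congˡ (⋆≈ f g) ⟨
    a * (f ⋆ g)                                    ∎

  ⋆-frobeniusPoly : ∀ x g → frobeniusPoly x ⋆ g ≈ eval g x
  ⋆-frobeniusPoly x g = begin
    frobeniusPoly x ⋆ g                            ≈⟨ ⋆≈ (frobeniusPoly x) g ⟩
    sum (λ i → sum (λ j → x i ^q^ j * g i j))      ≈⟨ sum-cong-≋ (λ i → sum-cong-≋ {n} (λ j → *-comm _ (g i j))) ⟩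
    sum (λ i → evaluate₁ (g i) (x i))              ≈⟨ eval≈ g x ⟨
    eval g x                                       ∎

  -- Σⱼ (xᵢ yᵢ)^(q^j) is the trace of xᵢ yᵢ
  frobeniusPoly-InFq-valued : ∀ x y → InFq (eval (frobeniusPoly x) y)
  frobeniusPoly-InFq-valued x y = InFq-resp (sym (trans (eval≈ (frobeniusPoly x) y) (sum-cong-≋ (λ i → sum-cong-≋ {n} λ j →
      trans (sym (^-distrib-* (x i) (y i) (q ℕ.^ toℕ j))) (sym (*-identityˡ _))))))
    (InFq-sum (λ i → evaluate₁ {n} (λ _ → 1#) (x i * y i)) (λ i → trace-InFq (x i * y i)))

  frobeniusPoly≈0⇒x≈0 : ∀ x → frobeniusPoly x ≈P 0P → IsZeroVec x
  frobeniusPoly≈0⇒x≈0 x x^q^j≈0 i = trans (sym (x^q^first≈x (x i))) (x^q^j≈0 i first)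

  InFq-valued⇒frobeniusPoly : ∀ h → (∀ x → InFq (eval h x)) → h ≈P frobeniusPoly (λ i → h i first)
  InFq-valued⇒frobeniusPoly h h∈ i =
    InFq-valued⇒orbit (h i) (λ z → InFq-resp (eval-δ h i z) (h∈ (δ i z))) first (Fin.toℕ-fromℕ< 1≤n)

  rank-zero⇒zero : ∀ f → HasRank f 0 → f ≈P 0P
  rank-zero⇒zero f H = eval-vanishing f λ x → proj₂ (proj₂ (HasFqDim.span H (λ _ → eval f x) (x , λ _ → refl))) zero

  rank-one⇒Fq-multiples : ∀ f → HasRank f 1 → Σ Carrier λ w → ∀ x → Σ Carrier λ a → InFq a × eval f x ≈ a * w
  rank-one⇒Fq-multiples f H = vec zero zero , λ x → let (a , a∈ , fx≈) = span (λ _ → eval f x) (x , λ _ → refl) in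
    a zero , IsFq⇒InFq (a∈ zero) , trans (fx≈ zero) (+-identityʳ _)
    where open HasFqDim H

  -- w⁻¹ f is F_q-valued, hence a Frobenius polynomial; duality then puts its root in every kernel
  Fq-multiples-dual⇒zero : KernelsTrivial C → ∀ {f} w → Dual C f →
                           (∀ x → Σ Carrier λ a → InFq a × eval f x ≈ a * w) → f ≈P 0P
  Fq-multiples-dual⇒zero trivial {f} w f∈dual multiples with w ≟ 0#
  ... | yes w≈0 = eval-vanishing f λ x → let (a , _ , fx≈) = multiples x in trans fx≈ (trans (*-congˡ w≈0) (zeroʳ a))
  ... | no  w≉0 = λ i j → *-cancelˡ w⁻¹≉0 (trans (h≈0 i j) (sym (zeroʳ _)))
    where
    w⁻¹ : Carrier
    w⁻¹ = w ⁻¹⟨ w≉0 ⟩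
    w⁻¹≉0 : ¬ w⁻¹ ≈ 0#
    w⁻¹≉0 w⁻¹≈0 = 1≉0 (trans (sym (*-inverseʳ w w≉0)) (trans (*-congˡ w⁻¹≈0) (zeroʳ w)))
    h : LinPoly
    h = w⁻¹ ·P f
    h-InFq-valued : ∀ x → InFq (eval h x)
    h-InFq-valued x with (a , a∈ , fx≈) ← multiples x = InFq-resp (sym (begin
      eval h x              ≈⟨ eval-·P w⁻¹ f x ⟩
      w⁻¹ * eval f x        ≈⟨ *-congˡ fx≈ ⟩
      w⁻¹ * (a * w)         ≈⟨ x*[y*z]≈y*[x*z] w⁻¹ a w ⟩
      a * (w⁻¹ * w)         ≈⟨ *-congˡ (*-inverseˡ w w≉0) ⟩
      a * 1#                ≈⟨ *-identityʳ a ⟩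
      a                     ∎)) a∈
    b : Vect m
    b i = h i first
    h≈frobeniusPoly : h ≈P frobeniusPoly b
    h≈frobeniusPoly = InFq-valued⇒frobeniusPoly h h-InFq-valued
    b∈ker : ∀ g → C g → eval g b ≈ 0#
    b∈ker g g∈C = begin
      eval g b                  ≈⟨ ⋆-frobeniusPoly b g ⟨
      frobeniusPoly b ⋆ g       ≈⟨ ⋆-congˡ g h≈frobeniusPoly ⟨
      h ⋆ g                     ≈⟨ ⋆-·P w⁻¹ f g ⟩
      w⁻¹ * (f ⋆ g)             ≈⟨ *-congˡ (f∈dual g g∈C) ⟩
      w⁻¹ * 0#                  ≈⟨ zeroʳ w⁻¹ ⟩
      0#                        ∎
    h≈0 : h ≈P 0P
    h≈0 i j = trans (h≈frobeniusPoly i j) (trans (^-congˡ (q ℕ.^ toℕ j) (trivial b b∈ker i)) (0^q^j≈0 j))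

  kernelsTrivial⇒minDist>1 : KernelsTrivial C → MinDistGreaterThanOne (Dual C)
  kernelsTrivial⇒minDist>1 trivial f f∈dual f≉0 zero          H = ⊥-elim (f≉0 (rank-zero⇒zero f H))
  kernelsTrivial⇒minDist>1 trivial f f∈dual f≉0 (suc zero)    H with (w , multiples) ← rank-one⇒Fq-multiples f H =
    ⊥-elim (f≉0 (Fq-multiples-dual⇒zero trivial w f∈dual multiples))
  kernelsTrivial⇒minDist>1 trivial f f∈dual f≉0 (suc (suc r)) H = s≤s (s≤s z≤n)

  InFq-valued⇒rank-one : ∀ f → (∀ y → InFq (eval f y)) → ¬ f ≈P 0P → HasRank f 1
  InFq-valued⇒rank-one f f∈ f≉0
    with search (λ y → ¬ eval f y ≈ 0#) (λ x≈y fx≉0 fy≈0 → fx≉0 (trans (eval-congʳ f x≈y) fy≈0))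
                (λ y → ¬? (eval f y ≟ 0#))
  ... | no  none       = ⊥-elim (f≉0 (eval-vanishing f λ y → decidable-stable (eval f y ≟ 0#) λ fy≉0 → none (y , fy≉0)))
  ... | yes (y₀ , w≉0) = record
    { vec   = λ _ _ → w
    ; in-U  = λ _ → y₀ , λ _ → refl
    ; indep = λ { a _ a·w≈0 zero → x*y≈0⇒y≈0 w≉0 (trans (*-comm w _) (trans (sym (+-identityʳ _)) (a·w≈0 zero))) }
    ; span  = λ u (y , u≈fy) → (λ _ → eval f y * w⁻¹) , (λ _ → InFq⇒IsFq (InFq-* (f∈ y) (InFq-⁻¹ w≉0 (f∈ y₀)))) ,
                λ s → trans (u≈fy s) (sym (trans (+-identityʳ _) (trans (*-assoc _ w⁻¹ w)
                        (trans (*-congˡ (*-inverseˡ w w≉0)) (*-identityʳ _)))))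
    }
    where
    w = eval f y₀
    w⁻¹ = w ⁻¹⟨ w≉0 ⟩

  -- a nonzero x in every kernel makes the rank-one polynomial frobeniusPoly x an element of the dual
  minDist>1⇒kernelsTrivial : MinDistGreaterThanOne (Dual C) → KernelsTrivial C
  minDist>1⇒kernelsTrivial minDist x x∈ker = decidable-stable (IsZeroVec? x) λ x≉0 →
    ℕ.<-irrefl ≡.refl (minDist (frobeniusPoly x) x-dual (x≉0 ∘ frobeniusPoly≈0⇒x≈0 x) 1
      (InFq-valued⇒rank-one (frobeniusPoly x) (frobeniusPoly-InFq-valued x) (x≉0 ∘ frobeniusPoly≈0⇒x≈0 x)))
    where
    x-dual : Dual C (frobeniusPoly x)
    x-dual g g∈C = trans (⋆-frobeniusPoly x g) (x∈ker g g∈C)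

open import Data.Nat using (_^_)
open import Function.Bundles using (_⇔_; mk⇔)

proposition2p11 : ∀ {c ℓ p : Level} (q n m : ℕ) → IsPrimePower q → 1 ≤ n → 1 ≤ m →
    (F : Field c ℓ) → HasCardinality F (q ^ n) →
    let open LinearizedPolynomials F q n m in
    (C : LinPoly → Set p) → IsCode C →
    (Nondegenerate C ⇔ BasisKernelsTrivial C) ×
    (Nondegenerate C ⇔ KernelsTrivial C) ×
    (Nondegenerate C ⇔ MinDistGreaterThanOne (Dual C))
-- the argument does not need 1 ≤ m
proposition2p11 q n m q-primePower 1≤n _ F card C code =
  mk⇔ (kernelsTrivial⇒basisKernelsTrivial ∘ nondegenerate⇒kernelsTrivial)
      (kernelsTrivial⇒nondegenerate ∘ basisKernelsTrivial⇒kernelsTrivial) ,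
  mk⇔ nondegenerate⇒kernelsTrivial kernelsTrivial⇒nondegenerate ,
  mk⇔ (kernelsTrivial⇒minDist>1 ∘ nondegenerate⇒kernelsTrivial)
      (kernelsTrivial⇒nondegenerate ∘ minDist>1⇒kernelsTrivial)
  where open Criteria F q-primePower 1≤n card C code
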